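{- Let $\mathcal{B}$ be a design over $\mathbb{F}_2$ with parameters $2$-$(v,k,\lambda_2)$, let $G\le GL_v(2)$ be an automorphism group of $\mathcal{B}$, and let $\Psi=\Psi_1\sqcup\cdots\sqcup\Psi_m$, $\mathcal{B}=\mathcal{B}_1\sqcup\cdots\sqcup\mathcal{B}_n$ be the tactical decomposition given by the $G$-orbits on points and on blocks, with tactical decomposition matrices $[\rho_{ij}]$, $[\kappa_{ij}]$. For $l,r,s\in\{1,\dots,m\}$ and a fixed point $P\in\Psi_l$ define $\sigma_{lrs}=|\{R\in\Psi_r\setminus\{P\}:P+R\in\Psi_s\}|$ (independent of the choice of $P\in\Psi_l$), and $$\phi^3_{rs}=\sum_{R\in\Psi_r}\ \sum_{\substack{S\in\Psi_s\\ \dim\langle P,R,S\rangle=3}} |\{B\in\mathcal{B}:\langle P,R,S\rangle\le B\}|.$$ Let $\lambda_1=\lambda_2\frac{2^{v-1}-1}{2^{k-1}-1}$ and $\varphi=\min\{\lambda_2,{v-3\brack k-3}_2\}$. Then $$\sum_{j=1}^n\rho_{lj}\kappa_{rj}\kappa_{sj}=\begin{cases}\sigma_{lrs}\lambda_2+\phi^3_{rs}, & l\ne r\ne s\ne l,\\ \lambda_1+(3|\Psi_l|+\sigma_{lrs}-3)\lambda_2+\phi^3_{rs}, & l=r=s,\\ (|\Psi_s|+\sigma_{lrs})\lambda_2+\phi^3_{rs}, & l=r\ne s\ \text{or}\ l\ne r=s,\end{cases}$$ and $$\phi^3_{rs}\le\begin{cases}(|\Psi_r|\,|\Psi_s|-\sigma_{lrs})\varphi,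 & l\ne r\ne s\ne l,\\ (|\Psi_l|^2-3|\Psi_l|-\sigma_{lrs}+2)\varphi, & l=r=s,\\ (|\Psi_r|\,|\Psi_s|-|\Psi_s|-\sigma_{lrs})\varphi, & l=r\ne s\ \text{or}\ l\ne r=s.\end{cases}$$
   Context: ${a\brack b}_2=\frac{(2^a-1)\cdots(2^{a-b+1}-1)}{(2^b-1)\cdots(2-1)}$ is the number of $b$-dimensional subspaces of $\mathbb{F}_2^a$. Points are the $1$-dimensional subspaces of $\mathbb{F}_2^v$; $\Psi$ is the set of all points. For distinct points $P,R$, $P+R$ is the third point of the $2$-space $\langle P,R\rangle$. A design over $\mathbb{F}_2$ with parameters $2$-$(v,k,\lambda_2)$ is a finite set $\mathcal{B}$ of $k$-dimensional subspaces (blocks) of $\mathbb{F}_2^v$ such that every $2$-dimensional subspace lies in exactly $\lambda_2$ blocks (so each point lies in exactly $\lambda_1$ blocks). An automorphism group is a subgroup $G\le GL_v(2)$ with $\Phi\mathcal{B}=\mathcal{B}$ for all $\Phi\in G$. The $G$-orbits on points and on blocks form a tactical decomposition: there are integers $\rho_{ij},\kappa_{ij}$ such that every point of $\Psi_i$ lies in exactly $\rho_{ij}$ blocks of $\mathcal{B}_j$, and every block of $\mathcal{B}_j$ contains exactly $\kappa_{ij}$ points of $\Psi_i$. The notation $l\ne r\ne s\ne l$ means $l,r,s$ pairwise distinct. -}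

module Defs where

open import Data.Bool using (Bool; true; false; not; _∧_; _∨_; _xor_; if_then_else_)
open import Data.Nat using (ℕ; zero; suc; _+_; _*_; _∸_; _^_; _≤_; _<_; _<ᵇ_; _≡ᵇ_; NonZero; >-nonZero; _/_)
open import Data.Nat.Properties using (m^n>0; *-monoʳ-≤; m<n⇒0<n∸m; m*n≢0)
open import Data.Fin using (Fin; _≟_)
open import Data.List using (List; []; _∷_; _++_; map; length; allFin; filter; sum)
open import Data.Vec using (Vec; []; _∷_; zipWith; replicate; foldr′; tabulate)
import Data.Vec as V
open import Data.Product using (Σ; _×_)
open import Relation.Binary.PropositionalEquality using (_≡_)
open import Relation.Nullary.Decidable using (⌊_⌋)

-- Points (1-dimensional subspaces) are identified with nonzero vectors
-- (over F_2 each 1-space has exactly one nonzero vector).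

Vect : ℕ → Set
Vect v = Vec Bool v

zeroV : ∀ {v} → Vect v
zeroV = replicate _ false

_⊕_ : ∀ {v} → Vect v → Vect v → Vect v
x ⊕ y = zipWith _xor_ x y

eqV : ∀ {v} → Vect v → Vect v → Bool
eqV [] [] = true
eqV (a ∷ x) (b ∷ y) = not (a xor b) ∧ eqV x y

isZeroV : ∀ {v} → Vect v → Bool
isZeroV x = eqV x zeroV

isPoint : ∀ {v} → Vect v → Bool
isPoint x = not (isZeroV x)

allVecs : (v : ℕ) → List (Vect v)
allVecs zero = [] ∷ []
allVecs (suc v) = map (true ∷_) (allVecs v) ++ map (false ∷_) (allVecs v)

countL : ∀ {A : Set} → (A → Bool) → List A → ℕ
countL p [] = 0
countL p (a ∷ as) = (if p a then 1 else 0) + countL p as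

sumL : ∀ {A : Set} → (A → ℕ) → List A → ℕ
sumL f [] = 0
sumL f (a ∷ as) = f a + sumL f as

countFin : (n : ℕ) → (Fin n → Bool) → ℕ
countFin n p = countL p (allFin n)

sumFin : (n : ℕ) → (Fin n → ℕ) → ℕ
sumFin n f = sumL f (allFin n)

countPts : ∀ {v} → (Vect v → Bool) → ℕ
countPts {v} p = countL (λ x → isPoint x ∧ p x) (allVecs v)

sumPts : ∀ {v} → (Vect v → ℕ) → ℕ
sumPts {v} f = sumL (λ x → if isPoint x then f x else 0) (allVecs v)

SubsetV : ℕ → Set
SubsetV v = Vect v → Bool

spanL : ∀ {v} → List (Vect v) → SubsetV v
spanL [] x = isZeroV x
spanL (u ∷ us) x = spanL us x ∨ spanL us (x ⊕ u)

dimSpan : ∀ {v} → List (Vect v) → ℕ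
dimSpan [] = 0
dimSpan (u ∷ us) = if spanL us u then dimSpan us else suc (dimSpan us)

IsSubspaceDim : ∀ {v} → ℕ → SubsetV v → Set
IsSubspaceDim {v} k U =
  Σ (List (Vect v)) λ bs → (length bs ≡ k) × (dimSpan bs ≡ k) × (∀ x → U x ≡ spanL bs x)

subsetB : ∀ {v} → SubsetV v → SubsetV v → Bool
subsetB {v} U W = Data.List.foldr (λ x r → (not (U x) ∨ W x) ∧ r) true (allVecs v)

Mat : ℕ → Set
Mat v = Vec (Vect v) v

dot : ∀ {v} → Vect v → Vect v → Bool
dot x y = foldr′ _xor_ false (zipWith _∧_ x y)

act : ∀ {v} → Mat v → Vect v → Vect v
act M x = V.map (λ row → dot row x) M

lincomb : ∀ {v w} → Vec Bool w → Vec (Vect v) w → Vect v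
lincomb [] [] = zeroV
lincomb (c ∷ cs) (r ∷ rs) = (if c then r else zeroV) ⊕ lincomb cs rs

_⊛_ : ∀ {v} → Mat v → Mat v → Mat v
M ⊛ N = V.map (λ row → lincomb row N) M

idMat : ∀ {v} → Mat v
idMat = tabulate (λ i → tabulate (λ j → ⌊ i ≟ j ⌋))

IsSubgroupGL : ∀ {v} → (Mat v → Set) → Set
IsSubgroupGL {v} G =
  G idMat
  × (∀ M N → G M → G N → G (M ⊛ N))
  × (∀ M → G M → Σ (Mat v) λ M' → G M' × (M ⊛ M' ≡ idMat) × (M' ⊛ M ≡ idMat))

gnum : ℕ → ℕ → ℕ
gnum a zero = 1
gnum a (suc b) = (2 ^ (a ∸ b) ∸ 1) * gnum a b

gden : ℕ → ℕ
gden zero = 1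
gden (suc b) = (2 ^ suc b ∸ 1) * gden b

gden-nz : ∀ b → NonZero (gden b)
gden-nz zero = _
gden-nz (suc b) =
  m*n≢0 (2 ^ suc b ∸ 1) (gden b)
    {{>-nonZero (m<n⇒0<n∸m (*-monoʳ-≤ 2 (m^n>0 2 b)))}} {{gden-nz b}}

gauss : ℕ → ℕ → ℕ
gauss a b = _/_ (gnum a b) (gden b) {{gden-nz b}}

-- [v-3 brack k-3]_2, taken to be 0 when k < 3 (negative lower index)
gaussVK3 : ℕ → ℕ → ℕ
gaussVK3 v k = if k <ᵇ 3 then 0 else gauss (v ∸ 3) (k ∸ 3)

minℕ : ℕ → ℕ → ℕ
minℕ = Data.Nat._⊓_

-- Quantities attached to the tactical decomposition.
-- po : point ↦ index of its G-orbit Ψ_i  (i : Fin m)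
-- bo : block ↦ index of its G-orbit B_j  (j : Fin n)

isIn : ∀ {m} → Fin m → Fin m → Bool
isIn i j = ⌊ i ≟ j ⌋

rhoP : ∀ {v N n} → (Fin N → SubsetV v) → (Fin N → Fin n) → Vect v → Fin n → ℕ
rhoP {N = N} B bo P j = countFin N (λ b → isIn (bo b) j ∧ B b P)

kappaB : ∀ {v m} → (Vect v → Fin m) → Fin m → SubsetV v → ℕ
kappaB po i X = countPts (λ x → isIn (po x) i ∧ X x)

orbSize : ∀ {v m} → (Vect v → Fin m) → Fin m → ℕ
orbSize po i = countPts (λ x → isIn (po x) i)

sigmaP : ∀ {v m} → (Vect v → Fin m) → Vect v → Fin m → Fin m → ℕ
sigmaP po P r s = countPts (λ R → isIn (po R) r ∧ not (eqV R P) ∧ isIn (po (P ⊕ R)) s)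

phi3P : ∀ {v m N} → (Fin N → SubsetV v) → (Vect v → Fin m) → Vect v → Fin m → Fin m → ℕ
phi3P {N = N} B po P r s =
  sumPts (λ R → if isIn (po R) r
    then sumPts (λ S → if isIn (po S) s ∧ (dimSpan (P ∷ R ∷ S ∷ []) ≡ᵇ 3)
      then countFin N (λ b → subsetB (spanL (P ∷ R ∷ S ∷ [])) (B b))
      else 0)
    else 0)

-- Sum over the blocks β through P instead of over the block orbits (κ is G-invariant): then
-- ∑_j ρ_lj κ_rj κ_sj counts the triples (β, R, S) with R ∈ Ψ_r, S ∈ Ψ_s and P, R, S ∈ β, i.e. it is the sum over
-- (R, S) ∈ Ψ_r × Ψ_s of the number of blocks through P, R, S. Sort the pairs by the configuration of P, R, S.
-- If R = S = P there are λ₁ such blocks. If ⟨P,R,S⟩ is a plane (R = P ≠ S, S = P ≠ R, R = S ≠ P or S = P + R)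
-- there are λ₂, and these pairs number [P ∈ Ψ_r] |Ψ_s ∖ P|, [P ∈ Ψ_s] |Ψ_r ∖ P|, |Ψ_r ∩ Ψ_s ∖ P| and σ_lrs,
-- the first three depending only on which of r, s equal l. The remaining pairs span a 3-space and contribute φ³_rs. A 3-space lies in at most λ₂
-- blocks, and in at most [v-3, k-3]₂ distinct k-spaces, since each k-space through it contains the same number of
-- ordered completions of (P, R, S) to a basis; so φ³_rs is at most φ times the number of spanning pairs.

module Submission where

open import Defs
open import Algebra.Bundles using (CommutativeRing)
open import Data.Bool using (Bool; true; false; not; _∧_; _∨_; _xor_; if_then_else_; T)
open import Data.Bool.Properties
  using (⇔→≡; not-injective; ∧-assoc; ∧-idem; ∧-identityʳ; ∨-idem; ∧-distribʳ-xor;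
         xor-assoc; xor-comm; xor-identityʳ; xor-same; xor-∧-commutativeRing)
open import Data.Empty using (⊥; ⊥-elim)
open import Data.Fin using (Fin; _≟_) renaming (zero to fzero; suc to fsuc)
open import Data.Fin.Properties using (suc-injective)
open import Data.List using (List; []; _∷_; _++_; map; length; allFin; foldr)
open import Data.List.Membership.Propositional using (_∈_)
open import Data.List.Membership.Propositional.Properties using (∈-map⁺; ∈-++⁺ˡ; ∈-++⁺ʳ)
open import Data.List.Properties using (map-tabulate)
open import Data.List.Relation.Unary.Any using (here; there)
open import Data.Nat using (ℕ; zero; suc; _+_; _*_; _∸_; _^_; _≤_; _<_; z≤n; s≤s; _<ᵇ_; _≡ᵇ_; NonZero; >-nonZero)
open import Data.Nat.DivMod using (m*n/n≡m; /-monoˡ-≤)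
open import Data.Nat.Properties hiding (_≟_; suc-injective)
open import Data.Nat.Tactic.RingSolver using (solve-∀)
open import Data.Product using (Σ; _×_; _,_; proj₂; map₁)
open import Data.Sum using (_⊎_; inj₁; inj₂)
open import Data.Unit using (tt)
open import Data.Vec using (Vec; []; _∷_; tabulate; lookup)
import Data.Vec as Vec
open import Data.Vec.Properties
  using (zipWith-comm; zipWith-assoc; zipWith-identityʳ; map-∘; map-cong; map-const; tabulate∘lookup; tabulate-∘; tabulate-cong)
open import Function using (id; _∘_; _⇔_; mk⇔; Equivalence)
open import Relation.Binary.PropositionalEquality
open import Relation.Nullary using (yes; no)
open import Relation.Nullary.Decidable using (⌊_⌋)

open import Algebra.Properties.CommutativeSemigroup +-commutativeSemigroup
  using () renaming (interchange to +-+-interchange)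
open import Algebra.Properties.CommutativeSemigroup *-commutativeSemigroup
  using () renaming (interchange to *-*-interchange; x∙yz≈y∙xz to x*[y*z]≡y*[x*z])
open import Algebra.Properties.CommutativeSemigroup (CommutativeRing.+-commutativeSemigroup xor-∧-commutativeRing)
  using () renaming (interchange to xor-interchange)
open ≡-Reasoning

𝟙 : Bool → ℕ
𝟙 true = 1
𝟙 false = 0

𝟙-∧ : ∀ a b → 𝟙 (a ∧ b) ≡ 𝟙 a * 𝟙 b
𝟙-∧ true b = sym (+-identityʳ (𝟙 b))
𝟙-∧ false b = refl

𝟙*-≤ : ∀ a n → 𝟙 a * n ≤ n
𝟙*-≤ true n = ≤-reflexive (+-identityʳ n)
𝟙*-≤ false n = z≤n

𝟙-mono : ∀ {a b} → (a ≡ true → b ≡ true) → 𝟙 a ≤ 𝟙 b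
𝟙-mono {true} {true} _ = ≤-refl
𝟙-mono {true} {false} h with h refl
... | ()
𝟙-mono {false} _ = z≤n

module _ {A : Set} where

  sumL-cong : ∀ {f g : A → ℕ} xs → (∀ x → f x ≡ g x) → sumL f xs ≡ sumL g xs
  sumL-cong [] _ = refl
  sumL-cong (x ∷ xs) f≗g = cong₂ _+_ (f≗g x) (sumL-cong xs f≗g)

  sumL-mono : ∀ {f g : A → ℕ} xs → (∀ x → f x ≤ g x) → sumL f xs ≤ sumL g xs
  sumL-mono [] _ = z≤n
  sumL-mono (x ∷ xs) f≤g = +-mono-≤ (f≤g x) (sumL-mono xs f≤g)

  sumL-zero : ∀ xs → sumL {A} (λ _ → 0) xs ≡ 0
  sumL-zero [] = refl
  sumL-zero (_ ∷ xs) = sumL-zero xs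

  sumL-+ : ∀ (f g : A → ℕ) xs → sumL (λ x → f x + g x) xs ≡ sumL f xs + sumL g xs
  sumL-+ f g [] = refl
  sumL-+ f g (x ∷ xs) = begin
    f x + g x + sumL (λ x → f x + g x) xs ≡⟨ cong (f x + g x +_) (sumL-+ f g xs) ⟩
    f x + g x + (sumL f xs + sumL g xs)   ≡⟨ +-+-interchange (f x) (g x) _ _ ⟩
    f x + sumL f xs + (g x + sumL g xs)   ∎

  sumL-*ˡ : ∀ c (f : A → ℕ) xs → sumL (λ x → c * f x) xs ≡ c * sumL f xs
  sumL-*ˡ c f [] = sym (*-zeroʳ c)
  sumL-*ˡ c f (x ∷ xs) = trans (cong (c * f x +_) (sumL-*ˡ c f xs)) (sym (*-distribˡ-+ c (f x) _))

  sumL-*ʳ : ∀ c (f : A → ℕ) xs → sumL (λ x → f x * c) xs ≡ sumL f xs * c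
  sumL-*ʳ c f xs = begin
    sumL (λ x → f x * c) xs ≡⟨ sumL-cong xs (λ x → *-comm (f x) c) ⟩
    sumL (λ x → c * f x) xs ≡⟨ sumL-*ˡ c f xs ⟩
    c * sumL f xs           ≡⟨ *-comm c _ ⟩
    sumL f xs * c           ∎

  sumL-++ : ∀ (f : A → ℕ) xs ys → sumL f (xs ++ ys) ≡ sumL f xs + sumL f ys
  sumL-++ f [] ys = refl
  sumL-++ f (x ∷ xs) ys = trans (cong (f x +_) (sumL-++ f xs ys)) (sym (+-assoc (f x) _ _))

  countL≡sumL-𝟙 : ∀ (p : A → Bool) xs → countL p xs ≡ sumL (𝟙 ∘ p) xs
  countL≡sumL-𝟙 p [] = refl
  countL≡sumL-𝟙 p (x ∷ xs) with p x
  ... | true = cong suc (countL≡sumL-𝟙 p xs)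
  ... | false = countL≡sumL-𝟙 p xs

module _ {A C : Set} where

  sumL-map : ∀ (f : C → ℕ) (g : A → C) xs → sumL f (map g xs) ≡ sumL (f ∘ g) xs
  sumL-map f g [] = refl
  sumL-map f g (x ∷ xs) = cong (f (g x) +_) (sumL-map f g xs)

  sumL-comm : ∀ (f : A → C → ℕ) xs ys →
    sumL (λ x → sumL (f x) ys) xs ≡ sumL (λ y → sumL (λ x → f x y) xs) ys
  sumL-comm f [] ys = sym (sumL-zero ys)
  sumL-comm f (x ∷ xs) ys = begin
    sumL (f x) ys + sumL (λ x → sumL (f x) ys) xs          ≡⟨ cong (sumL (f x) ys +_) (sumL-comm f xs ys) ⟩
    sumL (f x) ys + sumL (λ y → sumL (λ x → f x y) xs) ys  ≡⟨ sym (sumL-+ (f x) _ ys) ⟩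
    sumL (λ y → f x y + sumL (λ x → f x y) xs) ys          ∎

  sumL-*-sumL : ∀ (f : A → ℕ) (g : C → ℕ) xs ys → sumL f xs * sumL g ys ≡ sumL (λ x → sumL (λ y → f x * g y) ys) xs
  sumL-*-sumL f g xs ys = begin
    sumL f xs * sumL g ys                          ≡⟨ sym (sumL-*ʳ (sumL g ys) f xs) ⟩
    sumL (λ x → f x * sumL g ys) xs                ≡⟨ sumL-cong xs (λ x → sym (sumL-*ˡ (f x) g ys)) ⟩
    sumL (λ x → sumL (λ y → f x * g y) ys) xs      ∎

eqV-refl : ∀ {v} (x : Vect v) → eqV x x ≡ true
eqV-refl [] = refl
eqV-refl (true ∷ x) = eqV-refl x
eqV-refl (false ∷ x) = eqV-refl x

eqV⇒≡ : ∀ {v} (x y : Vect v) → eqV x y ≡ true → x ≡ y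
eqV⇒≡ [] [] _ = refl
eqV⇒≡ (true ∷ x) (true ∷ y) e = cong (true ∷_) (eqV⇒≡ x y e)
eqV⇒≡ (false ∷ x) (false ∷ y) e = cong (false ∷_) (eqV⇒≡ x y e)
eqV⇒≡ (true ∷ x) (false ∷ y) ()
eqV⇒≡ (false ∷ x) (true ∷ y) ()

≡⇒eqV : ∀ {v} {x y : Vect v} → x ≡ y → eqV x y ≡ true
≡⇒eqV {x = x} refl = eqV-refl x

eqV-false⇒≢ : ∀ {v} {x y : Vect v} → eqV x y ≡ false → x ≢ y
eqV-false⇒≢ e x≡y with trans (sym e) (≡⇒eqV x≡y)
... | ()

eqV-sym : ∀ {v} (x y : Vect v) → eqV x y ≡ eqV y x
eqV-sym x y = ⇔→≡ (mk⇔ (≡⇒eqV ∘ sym ∘ eqV⇒≡ x y) (≡⇒eqV ∘ sym ∘ eqV⇒≡ y x))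

⊕-comm : ∀ {v} (x y : Vect v) → x ⊕ y ≡ y ⊕ x
⊕-comm = zipWith-comm xor-comm

⊕-assoc : ∀ {v} (x y z : Vect v) → (x ⊕ y) ⊕ z ≡ x ⊕ (y ⊕ z)
⊕-assoc = zipWith-assoc xor-assoc

⊕-identityʳ : ∀ {v} (x : Vect v) → x ⊕ zeroV ≡ x
⊕-identityʳ = zipWith-identityʳ xor-identityʳ

⊕-identityˡ : ∀ {v} (x : Vect v) → zeroV ⊕ x ≡ x
⊕-identityˡ x = trans (⊕-comm zeroV x) (⊕-identityʳ x)

⊕-self : ∀ {v} (x : Vect v) → x ⊕ x ≡ zeroV
⊕-self [] = refl
⊕-self (a ∷ x) = cong₂ _∷_ (xor-same a) (⊕-self x)

⊕-cancelʳ : ∀ {v} (x u : Vect v) → (x ⊕ u) ⊕ u ≡ x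
⊕-cancelʳ x u = begin
  (x ⊕ u) ⊕ u ≡⟨ ⊕-assoc x u u ⟩
  x ⊕ (u ⊕ u) ≡⟨ cong (x ⊕_) (⊕-self u) ⟩
  x ⊕ zeroV   ≡⟨ ⊕-identityʳ x ⟩
  x           ∎

⊕-cancelˡ : ∀ {v} (u x : Vect v) → u ⊕ (u ⊕ x) ≡ x
⊕-cancelˡ u x = begin
  u ⊕ (u ⊕ x) ≡⟨ sym (⊕-assoc u u x) ⟩
  (u ⊕ u) ⊕ x ≡⟨ cong (_⊕ x) (⊕-self u) ⟩
  zeroV ⊕ x   ≡⟨ ⊕-identityˡ x ⟩
  x           ∎

⊕≡zero⇒≡ : ∀ {v} {x y : Vect v} → x ⊕ y ≡ zeroV → x ≡ y
⊕≡zero⇒≡ {x = x} {y} e = begin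
  x           ≡⟨ sym (⊕-cancelʳ x y) ⟩
  (x ⊕ y) ⊕ y ≡⟨ cong (_⊕ y) e ⟩
  zeroV ⊕ y   ≡⟨ ⊕-identityˡ y ⟩
  y           ∎

eqV-⊕-zero : ∀ {v} (x y : Vect v) → eqV (x ⊕ y) zeroV ≡ eqV x y
eqV-⊕-zero x y = ⇔→≡ (mk⇔ (≡⇒eqV ∘ ⊕≡zero⇒≡ ∘ eqV⇒≡ (x ⊕ y) zeroV)
  (λ e → ≡⇒eqV (trans (cong (x ⊕_) (sym (eqV⇒≡ x y e))) (⊕-self x))))

point⇒eqV-zero : ∀ {v} (x : Vect v) → isPoint x ≡ true → eqV x zeroV ≡ false
point⇒eqV-zero x p with eqV x zeroV
... | false = refl

point⇒≢zero : ∀ {v} (x : Vect v) → isPoint x ≡ true → x ≢ zeroV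
point⇒≢zero x p = eqV-false⇒≢ (point⇒eqV-zero x p)

⊕-isPoint : ∀ {v} {P R : Vect v} → eqV R P ≡ false → isPoint (P ⊕ R) ≡ true
⊕-isPoint {P = P} {R} R≢P = cong not (trans (eqV-⊕-zero P R) (trans (eqV-sym P R) R≢P))

sumV : ∀ v → (Vect v → ℕ) → ℕ
sumV v f = sumL f (allVecs v)

sumV-suc : ∀ {v} (f : Vect (suc v) → ℕ) → sumV (suc v) f ≡ sumV v (f ∘ (true ∷_)) + sumV v (f ∘ (false ∷_))
sumV-suc {v} f = begin
  sumL f (map (true ∷_) (allVecs v) ++ map (false ∷_) (allVecs v))
    ≡⟨ sumL-++ f (map (true ∷_) (allVecs v)) _ ⟩
  sumL f (map (true ∷_) (allVecs v)) + sumL f (map (false ∷_) (allVecs v))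
    ≡⟨ cong₂ _+_ (sumL-map f _ (allVecs v)) (sumL-map f _ (allVecs v)) ⟩
  sumV v (f ∘ (true ∷_)) + sumV v (f ∘ (false ∷_)) ∎

sumV-one : ∀ v → sumV v (λ _ → 1) ≡ 2 ^ v
sumV-one zero = refl
sumV-one (suc v) = begin
  sumV (suc v) (λ _ → 1)                  ≡⟨ sumV-suc {v} (λ _ → 1) ⟩
  sumV v (λ _ → 1) + sumV v (λ _ → 1)     ≡⟨ cong₂ _+_ (sumV-one v) (trans (sumV-one v) (sym (+-identityʳ _))) ⟩
  2 ^ suc v                               ∎

sumV-pointMass : ∀ {v} (f : Vect v → ℕ) P → sumV v (λ x → 𝟙 (eqV x P) * f x) ≡ f P
sumV-pointMass {zero} f [] = trans (+-identityʳ _) (*-identityˡ _)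
sumV-pointMass {suc v} f (a ∷ P) = trans (sumV-suc {v} _) (split a)
  where
  split : ∀ a → sumV v (λ x → 𝟙 (eqV (true ∷ x) (a ∷ P)) * f (true ∷ x))
              + sumV v (λ x → 𝟙 (eqV (false ∷ x) (a ∷ P)) * f (false ∷ x)) ≡ f (a ∷ P)
  split true = trans (cong₂ _+_ (sumV-pointMass (f ∘ (true ∷_)) P) (sumL-zero (allVecs v))) (+-identityʳ _)
  split false = cong₂ _+_ (sumL-zero (allVecs v)) (sumV-pointMass (f ∘ (false ∷_)) P)

sumV-pointMass′ : ∀ {v} (f : Vect v → ℕ) P → sumV v (λ x → 𝟙 (eqV P x) * f x) ≡ f P
sumV-pointMass′ f P = trans (sumL-cong (allVecs _) (λ x → cong (λ b → 𝟙 b * f x) (eqV-sym P x)))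
  (sumV-pointMass f P)

term≤sumV : ∀ {v} (f : Vect v → ℕ) P → f P ≤ sumV v f
term≤sumV {v} f P = subst (_≤ sumV v f) (sumV-pointMass f P) (sumL-mono (allVecs v) restrict≤)
  where
  restrict≤ : ∀ x → 𝟙 (eqV x P) * f x ≤ f x
  restrict≤ x with eqV x P
  ... | true = ≤-reflexive (+-identityʳ (f x))
  ... | false = z≤n

sumV-bijection : ∀ {v} (f : Vect v → ℕ) (h h⁻¹ : Vect v → Vect v) →
  (∀ x → h⁻¹ (h x) ≡ x) → (∀ y → h (h⁻¹ y) ≡ y) → sumV v (f ∘ h) ≡ sumV v f
sumV-bijection {v} f h h⁻¹ left right = begin
  sumV v (f ∘ h)                                          ≡⟨ sumL-cong (allVecs v) (λ x → sym (sumV-pointMass′ f (h x))) ⟩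
  sumV v (λ x → sumV v (λ y → 𝟙 (eqV (h x) y) * f y))    ≡⟨ sumL-comm _ (allVecs v) (allVecs v) ⟩
  sumV v (λ y → sumV v (λ x → 𝟙 (eqV (h x) y) * f y))    ≡⟨ sumL-cong (allVecs v) (λ y → sumL-*ʳ (f y) _ (allVecs v)) ⟩
  sumV v (λ y → sumV v (λ x → 𝟙 (eqV (h x) y)) * f y)    ≡⟨ sumL-cong (allVecs v) (λ y → cong (_* f y) (fibre y)) ⟩
  sumV v (λ y → 1 * f y)                                  ≡⟨ sumL-cong (allVecs v) (λ y → *-identityˡ (f y)) ⟩
  sumV v f                                                ∎
  where
  fibre : ∀ y → sumV v (λ x → 𝟙 (eqV (h x) y)) ≡ 1
  fibre y = begin
    sumV v (λ x → 𝟙 (eqV (h x) y))          ≡⟨ sumL-cong (allVecs v) (λ x → trans (cong 𝟙 (hx≡y⇔x≡h⁻¹y x)) (sym (*-identityʳ _))) ⟩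
    sumV v (λ x → 𝟙 (eqV x (h⁻¹ y)) * 1)    ≡⟨ sumV-pointMass (λ _ → 1) (h⁻¹ y) ⟩
    1                                       ∎
    where
    hx≡y⇔x≡h⁻¹y : ∀ x → eqV (h x) y ≡ eqV x (h⁻¹ y)
    hx≡y⇔x≡h⁻¹y x = ⇔→≡ (mk⇔ (λ e → ≡⇒eqV (trans (sym (left x)) (cong h⁻¹ (eqV⇒≡ _ _ e))))
                             (λ e → ≡⇒eqV (trans (cong h (eqV⇒≡ _ _ e)) (right y))))

sumV-translate : ∀ {v} (f : Vect v → ℕ) u → sumV v (λ x → f (x ⊕ u)) ≡ sumV v f
sumV-translate f u = sumV-bijection f (_⊕ u) (_⊕ u) (λ x → ⊕-cancelʳ x u) (λ x → ⊕-cancelʳ x u)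

sumV-split : ∀ {v} (f : Vect v → ℕ) P → sumV v f ≡ sumV v (λ x → 𝟙 (not (eqV x P)) * f x) + f P
sumV-split {v} f P = begin
  sumV v f                                                       ≡⟨ sumL-cong (allVecs v) pointwise ⟩
  sumV v (λ x → 𝟙 (not (eqV x P)) * f x + 𝟙 (eqV x P) * f x)    ≡⟨ sumL-+ _ _ (allVecs v) ⟩
  sumV v (λ x → 𝟙 (not (eqV x P)) * f x) + sumV v (λ x → 𝟙 (eqV x P) * f x)
                                                                 ≡⟨ cong (sumV v (λ x → 𝟙 (not (eqV x P)) * f x) +_) (sumV-pointMass f P) ⟩
  sumV v (λ x → 𝟙 (not (eqV x P)) * f x) + f P                  ∎
  where
  pointwise : ∀ x → f x ≡ 𝟙 (not (eqV x P)) * f x + 𝟙 (eqV x P) * f x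
  pointwise x with eqV x P
  ... | true = sym (+-identityʳ (f x))
  ... | false = sym (trans (+-identityʳ _) (+-identityʳ (f x)))

_⊆_ : ∀ {v} → SubsetV v → SubsetV v → Set
U ⊆ W = ∀ x → U x ≡ true → W x ≡ true

IsSubspace : ∀ {v} → SubsetV v → Set
IsSubspace U = U zeroV ≡ true × (∀ x y → U x ≡ true → U y ≡ true → U (x ⊕ y) ≡ true)

allIn : ∀ {v} → SubsetV v → List (Vect v) → Bool
allIn U [] = true
allIn U (u ∷ us) = U u ∧ allIn U us

card : ∀ {v} → SubsetV v → ℕ
card {v} U = sumV v (𝟙 ∘ U)

∨-introˡ : ∀ {a} b → a ≡ true → (a ∨ b) ≡ true
∨-introˡ b refl = refl

∨-introʳ : ∀ a {b} → b ≡ true → (a ∨ b) ≡ true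
∨-introʳ true _ = refl
∨-introʳ false e = e

∨-elim : ∀ {C : Set} a b → (a ∨ b) ≡ true → (a ≡ true → C) → (b ≡ true → C) → C
∨-elim true b _ f g = f refl
∨-elim false b e f g = g e

∧-intro : ∀ {a b} → a ≡ true → b ≡ true → (a ∧ b) ≡ true
∧-intro refl refl = refl

∧-projˡ : ∀ a b → (a ∧ b) ≡ true → a ≡ true
∧-projˡ true b _ = refl

∧-projʳ : ∀ a b → (a ∧ b) ≡ true → b ≡ true
∧-projʳ true b e = e

zero∈span : ∀ {v} (bs : List (Vect v)) → spanL bs zeroV ≡ true
zero∈span {v} [] = eqV-refl (zeroV {v})
zero∈span (u ∷ us) = ∨-introˡ _ (zero∈span us)

span-⊕-closed : ∀ {v} (bs : List (Vect v)) x y → spanL bs x ≡ true → spanL bs y ≡ true → spanL bs (x ⊕ y) ≡ true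
span-⊕-closed {v} [] x y x∈ y∈ =
  ≡⇒eqV (trans (cong₂ _⊕_ (eqV⇒≡ x zeroV x∈) (eqV⇒≡ y zeroV y∈)) (⊕-self (zeroV {v})))
span-⊕-closed (u ∷ us) x y x∈ y∈ =
  ∨-elim _ _ x∈
    (λ x∈us → ∨-elim _ _ y∈
      (λ y∈us → ∨-introˡ _ (closed x y x∈us y∈us))
      (λ y+u∈us → ∨-introʳ _ (subst∈ (sym (⊕-assoc x y u)) (closed x (y ⊕ u) x∈us y+u∈us))))
    (λ x+u∈us → ∨-elim _ _ y∈
      (λ y∈us → ∨-introʳ _ (subst∈ (swap-u x y) (closed (x ⊕ u) y x+u∈us y∈us)))
      (λ y+u∈us → ∨-introˡ _ (subst∈ (cancel-u x y) (closed (x ⊕ u) (y ⊕ u) x+u∈us y+u∈us))))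
  where
  closed = span-⊕-closed us
  subst∈ : ∀ {a b} → a ≡ b → spanL us a ≡ true → spanL us b ≡ true
  subst∈ e = subst (λ z → spanL us z ≡ true) e
  swap-u : ∀ x y → (x ⊕ u) ⊕ y ≡ (x ⊕ y) ⊕ u
  swap-u x y = begin
    (x ⊕ u) ⊕ y ≡⟨ ⊕-assoc x u y ⟩
    x ⊕ (u ⊕ y) ≡⟨ cong (x ⊕_) (⊕-comm u y) ⟩
    x ⊕ (y ⊕ u) ≡⟨ sym (⊕-assoc x y u) ⟩
    (x ⊕ y) ⊕ u ∎
  cancel-u : ∀ x y → (x ⊕ u) ⊕ (y ⊕ u) ≡ x ⊕ y
  cancel-u x y = begin
    (x ⊕ u) ⊕ (y ⊕ u) ≡⟨ sym (⊕-assoc (x ⊕ u) y u) ⟩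
    ((x ⊕ u) ⊕ y) ⊕ u ≡⟨ cong (_⊕ u) (swap-u x y) ⟩
    ((x ⊕ y) ⊕ u) ⊕ u ≡⟨ ⊕-cancelʳ (x ⊕ y) u ⟩
    x ⊕ y             ∎

span-isSubspace : ∀ {v} (bs : List (Vect v)) → IsSubspace (spanL bs)
span-isSubspace bs = zero∈span bs , span-⊕-closed bs

span-generators : ∀ {v} (bs : List (Vect v)) → allIn (spanL bs) bs ≡ true
span-generators [] = refl
span-generators (u ∷ us) = ∧-intro head∈ (tail∈ us (span-generators us))
  where
  head∈ : spanL (u ∷ us) u ≡ true
  head∈ = ∨-introʳ (spanL us u) (subst (λ z → spanL us z ≡ true) (sym (⊕-self u)) (zero∈span us))
  tail∈ : ∀ ws → allIn (spanL us) ws ≡ true → allIn (spanL (u ∷ us)) ws ≡ true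
  tail∈ [] _ = refl
  tail∈ (w ∷ ws) e = ∧-intro (∨-introˡ _ (∧-projˡ (spanL us w) _ e)) (tail∈ ws (∧-projʳ (spanL us w) _ e))

span-least : ∀ {v} {U : SubsetV v} → IsSubspace U → (bs : List (Vect v)) → allIn U bs ≡ true → spanL bs ⊆ U
span-least (0∈U , _) [] _ x x∈ rewrite eqV⇒≡ x zeroV x∈ = 0∈U
span-least {U = U} U-sub@(_ , closed) (u ∷ us) all∈ x x∈ = ∨-elim _ _ x∈
  (span-least U-sub us (∧-projʳ (U u) _ all∈) x)
  (λ x+u∈ → subst (λ z → U z ≡ true) (⊕-cancelʳ x u)
    (closed (x ⊕ u) u (span-least U-sub us (∧-projʳ (U u) _ all∈) (x ⊕ u) x+u∈) (∧-projˡ _ _ all∈)))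

subspace-translate : ∀ {v} {U : SubsetV v} → IsSubspace U → ∀ {u} → U u ≡ true → ∀ x → U (x ⊕ u) ≡ U x
subspace-translate {U = U} (_ , closed) {u} u∈ x =
  ⇔→≡ (mk⇔ (λ e → subst (λ z → U z ≡ true) (⊕-cancelʳ x u) (closed _ u e u∈)) (λ e → closed x u e u∈))

card-span : ∀ {v} (bs : List (Vect v)) → card (spanL bs) ≡ 2 ^ dimSpan bs
card-span {v} [] = trans (sumL-cong (allVecs v) (λ x → sym (*-identityʳ _))) (sumV-pointMass (λ _ → 1) (zeroV {v}))
card-span {v} (u ∷ us) with spanL us u in u∈us
... | true = begin
  sumV v (λ x → 𝟙 (spanL us x ∨ spanL us (x ⊕ u)))
    ≡⟨ sumL-cong (allVecs v) (λ x → cong (λ b → 𝟙 (spanL us x ∨ b)) (subspace-translate (span-isSubspace us) u∈us x)) ⟩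
  sumV v (λ x → 𝟙 (spanL us x ∨ spanL us x)) ≡⟨ sumL-cong (allVecs v) (λ x → cong 𝟙 (∨-idem (spanL us x))) ⟩
  card (spanL us)                             ≡⟨ card-span us ⟩
  2 ^ dimSpan us                              ∎
... | false = begin
  sumV v (λ x → 𝟙 (spanL us x ∨ spanL us (x ⊕ u)))
    ≡⟨ sumL-cong (allVecs v) (λ x → 𝟙-∨-disjoint (spanL us x) _ (disjoint x)) ⟩
  sumV v (λ x → 𝟙 (spanL us x) + 𝟙 (spanL us (x ⊕ u)))  ≡⟨ sumL-+ _ _ (allVecs v) ⟩
  card (spanL us) + sumV v (λ x → 𝟙 (spanL us (x ⊕ u))) ≡⟨ cong (card (spanL us) +_) (sumV-translate (𝟙 ∘ spanL us) u) ⟩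
  card (spanL us) + card (spanL us)                      ≡⟨ cong₂ _+_ (card-span us) (trans (card-span us) (sym (+-identityʳ _))) ⟩
  2 ^ suc (dimSpan us)                                   ∎
  where
  𝟙-∨-disjoint : ∀ a b → (a ≡ true → b ≡ true → ⊥) → 𝟙 (a ∨ b) ≡ 𝟙 a + 𝟙 b
  𝟙-∨-disjoint true true exclusive = ⊥-elim (exclusive refl refl)
  𝟙-∨-disjoint true false _ = refl
  𝟙-∨-disjoint false b _ = refl
  disjoint : ∀ x → spanL us x ≡ true → spanL us (x ⊕ u) ≡ true → ⊥
  disjoint x x∈ x+u∈ with trans (sym u∈us) (subst (λ z → spanL us z ≡ true) (⊕-cancelˡ x u) (span-⊕-closed us x (x ⊕ u) x∈ x+u∈))
  ... | ()

∈-allVecs : ∀ {v} (x : Vect v) → x ∈ allVecs v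
∈-allVecs [] = here refl
∈-allVecs {suc v} (true ∷ x) = ∈-++⁺ˡ (∈-map⁺ (true ∷_) (∈-allVecs x))
∈-allVecs {suc v} (false ∷ x) = ∈-++⁺ʳ (map (true ∷_) (allVecs v)) (∈-map⁺ (false ∷_) (∈-allVecs x))

⊆⇒subsetB : ∀ {v} {U W : SubsetV v} → U ⊆ W → subsetB U W ≡ true
⊆⇒subsetB {v} {U} {W} U⊆W = go (allVecs v)
  where
  go : ∀ xs → foldr (λ x r → (not (U x) ∨ W x) ∧ r) true xs ≡ true
  go [] = refl
  go (x ∷ xs) with U x in x∈U
  ... | true = ∧-intro (U⊆W x x∈U) (go xs)
  ... | false = go xs

subsetB⇒⊆ : ∀ {v} (U W : SubsetV v) → subsetB U W ≡ true → U ⊆ W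
subsetB⇒⊆ {v} U W U⊆ᵇW x = go (allVecs v) U⊆ᵇW (∈-allVecs x)
  where
  go : ∀ xs → foldr (λ x r → (not (U x) ∨ W x) ∧ r) true xs ≡ true → x ∈ xs → U x ≡ true → W x ≡ true
  go (y ∷ ys) all (here refl) x∈U rewrite x∈U = ∧-projˡ (W x) _ all
  go (y ∷ ys) all (there x∈ys) = go ys (∧-projʳ (not (U y) ∨ W y) _ all) x∈ys

subsetB-span : ∀ {v} {U : SubsetV v} → IsSubspace U → ∀ bs → subsetB (spanL bs) U ≡ allIn U bs
subsetB-span {U = U} U-sub bs = ⇔→≡ (mk⇔ (λ span⊆U → allIn-mono span⊆U bs (span-generators bs))
                                         (λ gens∈U → ⊆⇒subsetB (span-least U-sub bs gens∈U)))
  where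
  allIn-mono : ∀ {W} → subsetB W U ≡ true → ∀ ws → allIn W ws ≡ true → allIn U ws ≡ true
  allIn-mono W⊆U [] _ = refl
  allIn-mono {W} W⊆U (w ∷ ws) e = ∧-intro (subsetB⇒⊆ W U W⊆U w (∧-projˡ (W w) _ e)) (allIn-mono W⊆U ws (∧-projʳ (W w) _ e))

IsSubspaceDim⇒IsSubspace : ∀ {v k} {U : SubsetV v} → IsSubspaceDim k U → IsSubspace U
IsSubspaceDim⇒IsSubspace {U = U} (bs , _ , _ , U≗span) =
  as-U zeroV (zero∈span bs) ,
  λ x y x∈ y∈ → as-U (x ⊕ y) (span-⊕-closed bs x y (trans (sym (U≗span x)) x∈) (trans (sym (U≗span y)) y∈))
  where
  as-U : ∀ x → spanL bs x ≡ true → U x ≡ true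
  as-U x e = trans (U≗span x) e

IsSubspaceDim⇒card : ∀ {v k} {U : SubsetV v} → IsSubspaceDim k U → card U ≡ 2 ^ k
IsSubspaceDim⇒card {v} {k} {U} (bs , _ , dim≡k , U≗span) = begin
  card U             ≡⟨ sumL-cong (allVecs v) (λ x → cong 𝟙 (U≗span x)) ⟩
  card (spanL bs)    ≡⟨ card-span bs ⟩
  2 ^ dimSpan bs     ≡⟨ cong (2 ^_) dim≡k ⟩
  2 ^ k              ∎

card-difference : ∀ {v} {U W : SubsetV v} → U ⊆ W → card (λ x → not (U x) ∧ W x) + card U ≡ card W
card-difference {v} {U} {W} U⊆W = trans (sym (sumL-+ _ _ (allVecs v))) (sumL-cong (allVecs v) pointwise)
  where
  pointwise : ∀ x → 𝟙 (not (U x) ∧ W x) + 𝟙 (U x) ≡ 𝟙 (W x)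
  pointwise x with U x in x∈U
  ... | true rewrite U⊆W x x∈U = refl
  ... | false = +-identityʳ _

⊆-card-reverse : ∀ {v} {U W : SubsetV v} → U ⊆ W → card W ≤ card U → W ⊆ U
⊆-card-reverse {v} {U} {W} U⊆W |W|≤|U| x x∈W with U x in x∈U
... | true = refl
... | false = ⊥-elim (<⇒≱ |U|<|W| |W|≤|U|)
  where
  1≤|W∖U| : 1 ≤ card (λ y → not (U y) ∧ W y)
  1≤|W∖U| = subst (_≤ card (λ y → not (U y) ∧ W y)) (cong₂ (λ a b → 𝟙 (not a ∧ b)) x∈U x∈W)
                  (term≤sumV (λ y → 𝟙 (not (U y) ∧ W y)) x)
  |U|<|W| : card U < card W
  |U|<|W| = subst (card U <_) (trans (+-comm (card U) _) (card-difference U⊆W)) (m<m+n (card U) 1≤|W∖U|)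

dot-⊕ : ∀ {w} (a b x : Vec Bool w) → dot (a ⊕ b) x ≡ (dot a x xor dot b x)
dot-⊕ [] [] [] = refl
dot-⊕ (a ∷ as) (b ∷ bs) (x ∷ xs) = begin
  ((a xor b) ∧ x) xor dot (as ⊕ bs) xs                 ≡⟨ cong₂ _xor_ (∧-distribʳ-xor x a b) (dot-⊕ as bs xs) ⟩
  ((a ∧ x) xor (b ∧ x)) xor (dot as xs xor dot bs xs)  ≡⟨ xor-interchange (a ∧ x) (b ∧ x) _ _ ⟩
  ((a ∧ x) xor dot as xs) xor ((b ∧ x) xor dot bs xs)  ∎

dot-zeroˡ : ∀ {w} (x : Vec Bool w) → dot zeroV x ≡ false
dot-zeroˡ [] = refl
dot-zeroˡ (_ ∷ xs) = dot-zeroˡ xs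

dot-zeroʳ : ∀ {w} (x : Vec Bool w) → dot x zeroV ≡ false
dot-zeroʳ [] = refl
dot-zeroʳ (true ∷ xs) = dot-zeroʳ xs
dot-zeroʳ (false ∷ xs) = dot-zeroʳ xs

dot-lincomb : ∀ {v w} (c : Vec Bool w) (N : Vec (Vect v) w) (x : Vect v) →
  dot (lincomb c N) x ≡ dot c (Vec.map (λ row → dot row x) N)
dot-lincomb [] [] x = dot-zeroˡ x
dot-lincomb (c ∷ cs) (r ∷ rs) x = begin
  dot ((if c then r else zeroV) ⊕ lincomb cs rs) x           ≡⟨ dot-⊕ (if c then r else zeroV) (lincomb cs rs) x ⟩
  dot (if c then r else zeroV) x xor dot (lincomb cs rs) x   ≡⟨ cong₂ _xor_ (dot-scale c) (dot-lincomb cs rs x) ⟩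
  (c ∧ dot r x) xor dot cs (Vec.map (λ row → dot row x) rs)  ∎
  where
  dot-scale : ∀ c → dot (if c then r else zeroV) x ≡ (c ∧ dot r x)
  dot-scale true = refl
  dot-scale false = dot-zeroˡ x

act-⊛ : ∀ {v} (M N : Mat v) x → act (M ⊛ N) x ≡ act M (act N x)
act-⊛ M N x = begin
  Vec.map (λ row → dot row x) (Vec.map (λ row → lincomb row N) M) ≡⟨ sym (map-∘ (λ row → dot row x) (λ row → lincomb row N) M) ⟩
  Vec.map (λ row → dot (lincomb row N) x) M                       ≡⟨ map-cong (λ row → dot-lincomb row N x) M ⟩
  act M (act N x)                                                 ∎

dot-unitVector : ∀ {w} (i : Fin w) (x : Vec Bool w) → dot (tabulate (λ j → ⌊ i ≟ j ⌋)) x ≡ lookup x i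
dot-unitVector fzero (y ∷ ys) = trans (cong (y xor_) (dot-zeroˡ′ ys)) (xor-identityʳ y)
  where
  dot-zeroˡ′ : ∀ {w} (x : Vec Bool w) → dot (tabulate {n = w} (λ _ → false)) x ≡ false
  dot-zeroˡ′ [] = refl
  dot-zeroˡ′ (_ ∷ xs) = dot-zeroˡ′ xs
dot-unitVector (fsuc i) (y ∷ ys) = trans (cong (λ row → dot row ys) (tabulate-cong (λ j → ≟-suc j))) (dot-unitVector i ys)
  where
  ≟-suc : ∀ j → ⌊ fsuc i ≟ fsuc j ⌋ ≡ ⌊ i ≟ j ⌋
  ≟-suc j with i ≟ j
  ... | yes _ = refl
  ... | no _ = refl

act-id : ∀ {v} (x : Vect v) → act idMat x ≡ x
act-id x = begin
  Vec.map (λ row → dot row x) (tabulate (λ i → tabulate (λ j → ⌊ i ≟ j ⌋)))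
    ≡⟨ sym (tabulate-∘ (λ row → dot row x) _) ⟩
  tabulate (λ i → dot (tabulate (λ j → ⌊ i ≟ j ⌋)) x) ≡⟨ tabulate-cong (λ i → dot-unitVector i x) ⟩
  tabulate (lookup x)                                 ≡⟨ tabulate∘lookup x ⟩
  x                                                   ∎

act-zero : ∀ {v} (M : Mat v) → act M zeroV ≡ zeroV
act-zero M = trans (map-cong dot-zeroʳ M) (map-const M false)

Inverse : ∀ {v} → Mat v → Mat v → Set
Inverse g g⁻¹ = (∀ x → act g⁻¹ (act g x) ≡ x) × (∀ y → act g (act g⁻¹ y) ≡ y)

matrixInverse⇒Inverse : ∀ {v} {g g⁻¹ : Mat v} → g ⊛ g⁻¹ ≡ idMat → g⁻¹ ⊛ g ≡ idMat → Inverse g g⁻¹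
matrixInverse⇒Inverse {g = g} {g⁻¹} right left =
  (λ x → trans (sym (act-⊛ g⁻¹ g x)) (trans (cong (λ M → act M x) left) (act-id x))) ,
  (λ y → trans (sym (act-⊛ g g⁻¹ y)) (trans (cong (λ M → act M y) right) (act-id y)))

act-isPoint : ∀ {v} {g g⁻¹ : Mat v} → Inverse g g⁻¹ → ∀ x → isPoint (act g x) ≡ isPoint x
act-isPoint {g = g} {g⁻¹} (left , _) x = cong not (⇔→≡ (mk⇔
  (λ gx≡0 → ≡⇒eqV (trans (sym (left x)) (trans (cong (act g⁻¹) (eqV⇒≡ _ zeroV gx≡0)) (act-zero g⁻¹))))
  (λ x≡0 → ≡⇒eqV (trans (cong (act g) (eqV⇒≡ x zeroV x≡0)) (act-zero g)))))

countPts-cong : ∀ {v} {p q : Vect v → Bool} → (∀ x → isPoint x ≡ true → p x ≡ q x) → countPts p ≡ countPts q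
countPts-cong {v} {p} {q} p≗q = begin
  countPts p                           ≡⟨ countL≡sumL-𝟙 _ (allVecs v) ⟩
  sumV v (λ x → 𝟙 (isPoint x ∧ p x))   ≡⟨ sumL-cong (allVecs v) pointwise ⟩
  sumV v (λ x → 𝟙 (isPoint x ∧ q x))   ≡⟨ sym (countL≡sumL-𝟙 _ (allVecs v)) ⟩
  countPts q                           ∎
  where
  pointwise : ∀ x → 𝟙 (isPoint x ∧ p x) ≡ 𝟙 (isPoint x ∧ q x)
  pointwise x with isPoint x in x-pt
  ... | true = cong 𝟙 (p≗q x x-pt)
  ... | false = refl

countPts-act : ∀ {v} {g g⁻¹ : Mat v} → Inverse g g⁻¹ → (p : Vect v → Bool) → countPts (p ∘ act g) ≡ countPts p
countPts-act {v} {g} {g⁻¹} inv@(left , right) p = begin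
  countPts (p ∘ act g)                              ≡⟨ countL≡sumL-𝟙 _ (allVecs v) ⟩
  sumV v (λ x → 𝟙 (isPoint x ∧ p (act g x)))        ≡⟨ sumL-cong (allVecs v) (λ x → cong (λ b → 𝟙 (b ∧ p (act g x))) (sym (act-isPoint inv x))) ⟩
  sumV v (λ x → 𝟙 (isPoint (act g x) ∧ p (act g x))) ≡⟨ sumV-bijection (λ y → 𝟙 (isPoint y ∧ p y)) (act g) (act g⁻¹) left right ⟩
  sumV v (λ y → 𝟙 (isPoint y ∧ p y))               ≡⟨ sym (countL≡sumL-𝟙 _ (allVecs v)) ⟩
  countPts p                                        ∎

sumFin-suc : ∀ n (f : Fin (suc n) → ℕ) → sumFin (suc n) f ≡ f fzero + sumFin n (f ∘ fsuc)
sumFin-suc n f = cong (f fzero +_) (trans (cong (sumL f) (sym (map-tabulate id fsuc))) (sumL-map f fsuc (allFin n)))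

isIn⇒≡ : ∀ {m} {i j : Fin m} → isIn i j ≡ true → i ≡ j
isIn⇒≡ {i = i} {j} e with i ≟ j
... | yes i≡j = i≡j

isIn-refl : ∀ {m} (i : Fin m) → isIn i i ≡ true
isIn-refl i with i ≟ i
... | yes _ = refl
... | no i≢i = ⊥-elim (i≢i refl)

isIn-≢ : ∀ {m} {i j : Fin m} → i ≢ j → isIn i j ≡ false
isIn-≢ {i = i} {j} i≢j with i ≟ j
... | yes i≡j = ⊥-elim (i≢j i≡j)
... | no _ = refl

sumFin-indicator : ∀ n (i : Fin n) (c : Fin n → ℕ) → sumFin n (λ j → 𝟙 (isIn i j) * c j) ≡ c i
sumFin-indicator (suc n) fzero c = begin
  sumFin (suc n) (λ j → 𝟙 (isIn fzero j) * c j) ≡⟨ sumFin-suc n (λ j → 𝟙 (isIn fzero j) * c j) ⟩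
  c fzero + 0 + sumFin n (λ _ → 0)              ≡⟨ cong₂ _+_ (+-identityʳ (c fzero)) (sumL-zero (allFin n)) ⟩
  c fzero + 0                                   ≡⟨ +-identityʳ (c fzero) ⟩
  c fzero                                       ∎
sumFin-indicator (suc n) (fsuc i) c = begin
  sumFin (suc n) (λ j → 𝟙 (isIn (fsuc i) j) * c j)   ≡⟨ sumFin-suc n (λ j → 𝟙 (isIn (fsuc i) j) * c j) ⟩
  sumFin n (λ j → 𝟙 (isIn (fsuc i) (fsuc j)) * c (fsuc j))
    ≡⟨ sumL-cong (allFin n) (λ j → cong (λ b → 𝟙 b * c (fsuc j)) (isIn-suc j)) ⟩
  sumFin n (λ j → 𝟙 (isIn i j) * c (fsuc j))         ≡⟨ sumFin-indicator n i (c ∘ fsuc) ⟩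
  c (fsuc i)                                         ∎
  where
  isIn-suc : ∀ j → isIn (fsuc i) (fsuc j) ≡ isIn i j
  isIn-suc j with i ≟ j
  ... | yes _ = refl
  ... | no _ = refl

countFin≡sumFin-𝟙 : ∀ n (p : Fin n → Bool) → countFin n p ≡ sumFin n (𝟙 ∘ p)
countFin≡sumFin-𝟙 n p = countL≡sumL-𝟙 p (allFin n)

countFin-cong : ∀ n {p q : Fin n → Bool} → (∀ b → p b ≡ q b) → countFin n p ≡ countFin n q
countFin-cong n {p} {q} p≗q = begin
  countFin n p    ≡⟨ countFin≡sumFin-𝟙 n p ⟩
  sumFin n (𝟙 ∘ p) ≡⟨ sumL-cong (allFin n) (cong 𝟙 ∘ p≗q) ⟩
  sumFin n (𝟙 ∘ q) ≡⟨ sym (countFin≡sumFin-𝟙 n q) ⟩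
  countFin n q    ∎

countFin-mono : ∀ n {p q : Fin n → Bool} → (∀ b → p b ≡ true → q b ≡ true) → countFin n p ≤ countFin n q
countFin-mono n {p} {q} p⇒q = subst₂ _≤_ (sym (countFin≡sumFin-𝟙 n p)) (sym (countFin≡sumFin-𝟙 n q))
  (sumL-mono (allFin n) (λ b → 𝟙-mono (p⇒q b)))

countFin-suc : ∀ n (p : Fin (suc n) → Bool) → countFin (suc n) p ≡ 𝟙 (p fzero) + countFin n (p ∘ fsuc)
countFin-suc n p = begin
  countFin (suc n) p                        ≡⟨ countFin≡sumFin-𝟙 (suc n) p ⟩
  sumFin (suc n) (𝟙 ∘ p)                    ≡⟨ sumFin-suc n (𝟙 ∘ p) ⟩
  𝟙 (p fzero) + sumFin n (𝟙 ∘ p ∘ fsuc)     ≡⟨ cong (𝟙 (p fzero) +_) (sym (countFin≡sumFin-𝟙 n (p ∘ fsuc))) ⟩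
  𝟙 (p fzero) + countFin n (p ∘ fsuc)       ∎

countFin-none : ∀ n {p : Fin n → Bool} → (∀ b → p b ≡ false) → countFin n p ≡ 0
countFin-none n {p} none = trans (countFin-cong n none) (trans (countFin≡sumFin-𝟙 n (λ _ → false)) (sumL-zero (allFin n)))

countFin-unique : ∀ n (p : Fin n → Bool) → (∀ b b′ → p b ≡ true → p b′ ≡ true → b ≡ b′) → countFin n p ≤ 1
countFin-unique zero p _ = z≤n
countFin-unique (suc n) p unique rewrite countFin-suc n p with p fzero in p0
... | true = ≤-reflexive (cong suc (countFin-none n rest-false))
  where
  rest-false : ∀ b → p (fsuc b) ≡ false
  rest-false b with p (fsuc b) in pb
  ... | true with unique fzero (fsuc b) p0 pb
  ... | ()
  rest-false b | false = refl
... | false = countFin-unique n (p ∘ fsuc) (λ b b′ pb pb′ → suc-injective (unique (fsuc b) (fsuc b′) pb pb′))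

-- Configurations of two points relative to a third

x⊕y≡x⇒y≡0 : ∀ {v} {x y : Vect v} → x ⊕ y ≡ x → y ≡ zeroV
x⊕y≡x⇒y≡0 {x = x} {y} e = trans (sym (⊕-cancelˡ x y)) (trans (cong (x ⊕_) e) (⊕-self x))

x⊕y≡y⇒x≡0 : ∀ {v} {x y : Vect v} → x ⊕ y ≡ y → x ≡ zeroV
x⊕y≡y⇒x≡0 {x = x} {y} e = x⊕y≡x⇒y≡0 (trans (⊕-comm y x) e)

dimSpan-pair : ∀ {v} (X Y : Vect v) → isPoint X ≡ true → isPoint Y ≡ true → eqV X Y ≡ false →
  dimSpan (X ∷ Y ∷ []) ≡ 2
dimSpan-pair X Y X-pt Y-pt X≠Y
  rewrite point⇒eqV-zero X X-pt | point⇒eqV-zero Y Y-pt | eqV-⊕-zero X Y | X≠Y = refl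

module Configurations {v} (P : Vect v) (P-pt : isPoint P ≡ true) where

  indep R=S=P R=P≠S S=P≠R R=S≠P S=P+R : Vect v → Vect v → Bool
  indep R S = dimSpan (P ∷ R ∷ S ∷ []) ≡ᵇ 3
  R=S=P R S = eqV R P ∧ eqV S P
  R=P≠S R S = eqV R P ∧ not (eqV S P)
  S=P≠R R S = not (eqV R P) ∧ eqV S P
  R=S≠P R S = not (eqV R P) ∧ eqV R S
  S=P+R R S = not (eqV R P) ∧ eqV (P ⊕ R) S

  indep-iff : ∀ {R S} → isPoint R ≡ true → isPoint S ≡ true →
    indep R S ≡ not (eqV S P ∨ (eqV R P ∨ eqV (P ⊕ R) S)) ∧ not (eqV R S)
  indep-iff {R} {S} R-pt S-pt
    rewrite point⇒eqV-zero P P-pt | point⇒eqV-zero R R-pt | point⇒eqV-zero S S-pt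
          | eqV-⊕-zero P S | eqV-⊕-zero P R | eqV-⊕-zero (P ⊕ R) S | eqV-⊕-zero R S
          | eqV-sym P S | eqV-sym P R
    with eqV S P ∨ (eqV R P ∨ eqV (P ⊕ R) S) | eqV R S
  ... | true | true = refl
  ... | true | false = refl
  ... | false | true = refl
  ... | false | false = refl

  partition : ∀ {R S} → isPoint R ≡ true → isPoint S ≡ true →
    𝟙 (indep R S) + (𝟙 (R=S=P R S) + (𝟙 (R=P≠S R S) + (𝟙 (S=P≠R R S) + (𝟙 (R=S≠P R S) + 𝟙 (S=P+R R S))))) ≡ 1
  partition {R} {S} R-pt S-pt = trans (cong (λ b → 𝟙 b + rest) (indep-iff R-pt S-pt)) exactlyOne
    where
    rest : ℕ
    rest = 𝟙 (R=S=P R S) + (𝟙 (R=P≠S R S) + (𝟙 (S=P≠R R S) + (𝟙 (R=S≠P R S) + 𝟙 (S=P+R R S))))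
    exactlyOne : 𝟙 (not (eqV S P ∨ (eqV R P ∨ eqV (P ⊕ R) S)) ∧ not (eqV R S)) + rest ≡ 1
    exactlyOne with eqV R P in r≡p | eqV S P in s≡p | eqV R S in r≡s | eqV (P ⊕ R) S in s≡p+r
    ... | true  | true  | true  | false = refl
    ... | true  | false | false | false = refl
    ... | false | true  | false | false = refl
    ... | false | false | true  | false = refl
    ... | false | false | false | true  = refl
    ... | false | false | false | false = refl
    ... | true  | _     | _     | true  = ⊥-elim (point⇒≢zero S S-pt (begin
      S     ≡⟨ sym (eqV⇒≡ _ S s≡p+r) ⟩
      P ⊕ R ≡⟨ cong (P ⊕_) (eqV⇒≡ R P r≡p) ⟩
      P ⊕ P ≡⟨ ⊕-self P ⟩
      zeroV ∎))
    ... | true  | true  | false | _     = ⊥-elim (eqV-false⇒≢ r≡s (trans (eqV⇒≡ R P r≡p) (sym (eqV⇒≡ S P s≡p))))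
    ... | true  | false | true  | _     = ⊥-elim (eqV-false⇒≢ s≡p (trans (sym (eqV⇒≡ R S r≡s)) (eqV⇒≡ R P r≡p)))
    ... | false | true  | true  | _     = ⊥-elim (eqV-false⇒≢ r≡p (trans (eqV⇒≡ R S r≡s) (eqV⇒≡ S P s≡p)))
    ... | false | true  | false | true  =
      ⊥-elim (point⇒≢zero R R-pt (x⊕y≡x⇒y≡0 (trans (eqV⇒≡ _ S s≡p+r) (eqV⇒≡ S P s≡p))))
    ... | false | false | true  | true  =
      ⊥-elim (point⇒≢zero P P-pt (x⊕y≡y⇒x≡0 (trans (eqV⇒≡ _ S s≡p+r) (sym (eqV⇒≡ R S r≡s)))))

sumV-split-P-zero : ∀ {v} {P : Vect v} → isPoint P ≡ true → (f : Vect v → ℕ) →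
  sumV v f ≡ sumV v (λ x → 𝟙 (isPoint x ∧ not (eqV x P)) * f x) + f P + f zeroV
sumV-split-P-zero {v} {P} P-pt f = begin
  sumV v f
    ≡⟨ sumL-cong (allVecs v) pointwise ⟩
  sumV v (λ x → 𝟙 (isPoint x ∧ not (eqV x P)) * f x + 𝟙 (eqV x P) * f x + 𝟙 (eqV x zeroV) * f x)
    ≡⟨ trans (sumL-+ _ _ (allVecs v)) (cong (_+ _) (sumL-+ _ _ (allVecs v))) ⟩
  sumV v (λ x → 𝟙 (isPoint x ∧ not (eqV x P)) * f x) + sumV v (λ x → 𝟙 (eqV x P) * f x) + sumV v (λ x → 𝟙 (eqV x zeroV) * f x)
    ≡⟨ cong₂ (λ a b → sumV v (λ x → 𝟙 (isPoint x ∧ not (eqV x P)) * f x) + a + b) (sumV-pointMass f P) (sumV-pointMass f zeroV) ⟩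
  sumV v (λ x → 𝟙 (isPoint x ∧ not (eqV x P)) * f x) + f P + f zeroV ∎
  where
  pointwise : ∀ x → f x ≡ 𝟙 (isPoint x ∧ not (eqV x P)) * f x + 𝟙 (eqV x P) * f x + 𝟙 (eqV x zeroV) * f x
  pointwise x with eqV x zeroV in x≡0 | eqV x P in x≡P
  ... | true | true = ⊥-elim (point⇒≢zero P P-pt (trans (sym (eqV⇒≡ x P x≡P)) (eqV⇒≡ x zeroV x≡0)))
  ... | true | false = sym (+-identityʳ (f x))
  ... | false | true = sym (trans (+-identityʳ _) (+-identityʳ (f x)))
  ... | false | false = sym (trans (+-identityʳ _) (trans (+-identityʳ _) (+-identityʳ (f x))))

2^[1+n]∸2 : ∀ n → 2 ^ suc n ∸ 2 ≡ 2 * (2 ^ n ∸ 1)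
2^[1+n]∸2 n = sym (*-distribˡ-∸ 2 (2 ^ n) 1)

-- Cancels the common factor 2 (2^(k-1) - 1) of the two counting identities for λ₁.
λ₁-unique : ∀ {k v r λ₁ λ₂} → 2 ≤ k → k ≤ v →
  r * (2 ^ k ∸ 2) ≡ λ₂ * (2 ^ v ∸ 2) → λ₁ * (2 ^ (k ∸ 1) ∸ 1) ≡ λ₂ * (2 ^ (v ∸ 1) ∸ 1) → r ≡ λ₁
λ₁-unique {suc (suc k)} {suc v} {r} {λ₁} {λ₂} (s≤s (s≤s _)) _ r-eq λ₁-eq =
  *-cancelʳ-≡ r λ₁ (2 ^ suc k ∸ 1) {{>-nonZero (m<n⇒0<n∸m (*-monoʳ-≤ 2 (m^n>0 2 k)))}}
    (trans r-halved (sym λ₁-eq))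
  where
  r-halved : r * (2 ^ suc k ∸ 1) ≡ λ₂ * (2 ^ v ∸ 1)
  r-halved = *-cancelˡ-≡ _ _ 2 (begin
    2 * (r * (2 ^ suc k ∸ 1))   ≡⟨ sym (x*[y*z]≡y*[x*z] r 2 _) ⟩
    r * (2 * (2 ^ suc k ∸ 1))   ≡⟨ cong (r *_) (sym (2^[1+n]∸2 (suc k))) ⟩
    r * (2 ^ suc (suc k) ∸ 2)   ≡⟨ r-eq ⟩
    λ₂ * (2 ^ suc v ∸ 2)        ≡⟨ cong (λ₂ *_) (2^[1+n]∸2 v) ⟩
    λ₂ * (2 * (2 ^ v ∸ 1))      ≡⟨ x*[y*z]≡y*[x*z] λ₂ 2 _ ⟩
    2 * (λ₂ * (2 ^ v ∸ 1))      ∎)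

module Design {v k λ₂ N : ℕ} (B : Fin N → SubsetV v)
  (B-dim : ∀ b → IsSubspaceDim k (B b))
  (B-λ₂ : ∀ U → IsSubspaceDim 2 U → countFin N (λ b → subsetB U (B b)) ≡ λ₂) where

  B-subspace : ∀ b → IsSubspace (B b)
  B-subspace b = IsSubspaceDim⇒IsSubspace (B-dim b)

  blocksThrough₁ : Vect v → ℕ
  blocksThrough₁ X = countFin N (λ b → B b X)

  blocksThrough₂ : Vect v → Vect v → ℕ
  blocksThrough₂ X Y = countFin N (λ b → B b X ∧ B b Y)

  blocksThrough₃ : Vect v → Vect v → Vect v → ℕ
  blocksThrough₃ X Y Z = countFin N (λ b → B b X ∧ (B b Y ∧ B b Z))

  blocksThrough₂≡λ₂ : ∀ {X Y} → isPoint X ≡ true → isPoint Y ≡ true → eqV X Y ≡ false → blocksThrough₂ X Y ≡ λ₂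
  blocksThrough₂≡λ₂ {X} {Y} X-pt Y-pt X≠Y = begin
    countFin N (λ b → B b X ∧ B b Y)                         ≡⟨ countFin-cong N (λ b → sym (span⊆B b)) ⟩
    countFin N (λ b → subsetB (spanL (X ∷ Y ∷ [])) (B b))    ≡⟨ B-λ₂ _ ((X ∷ Y ∷ []) , refl , dimSpan-pair X Y X-pt Y-pt X≠Y , λ _ → refl) ⟩
    λ₂                                                        ∎
    where
    span⊆B : ∀ b → subsetB (spanL (X ∷ Y ∷ [])) (B b) ≡ (B b X ∧ B b Y)
    span⊆B b = trans (subsetB-span (B-subspace b) (X ∷ Y ∷ [])) (cong (B b X ∧_) (∧-identityʳ (B b Y)))

  blocksThrough₃≤blocksThrough₂ : ∀ X Y Z → blocksThrough₃ X Y Z ≤ blocksThrough₂ X Y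
  blocksThrough₃≤blocksThrough₂ X Y Z =
    countFin-mono N (λ b e → ∧-intro (∧-projˡ (B b X) _ e) (∧-projˡ (B b Y) (B b Z) (∧-projʳ (B b X) _ e)))

  subsetB-span₃ : ∀ X Y Z b → subsetB (spanL (X ∷ Y ∷ Z ∷ [])) (B b) ≡ (B b X ∧ (B b Y ∧ B b Z))
  subsetB-span₃ X Y Z b =
    trans (subsetB-span (B-subspace b) (X ∷ Y ∷ Z ∷ [])) (cong (λ c → B b X ∧ (B b Y ∧ c)) (∧-identityʳ (B b Z)))

  otherPoints : Vect v → SubsetV v → ℕ
  otherPoints P X = sumV v (λ x → 𝟙 (isPoint x ∧ not (eqV x P)) * 𝟙 (X x))

  otherPoints-subspace : ∀ {P} {X : SubsetV v} → isPoint P ≡ true → X P ≡ true → IsSubspace X →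
    otherPoints P X ≡ card X ∸ 2
  otherPoints-subspace {P} {X} P-pt P∈X (0∈X , _) = sym (begin
    card X ∸ 2                                    ≡⟨ cong (_∸ 2) (sumV-split-P-zero P-pt (𝟙 ∘ X)) ⟩
    otherPoints P X + 𝟙 (X P) + 𝟙 (X zeroV) ∸ 2   ≡⟨ cong₂ (λ a b → otherPoints P X + 𝟙 a + 𝟙 b ∸ 2) P∈X 0∈X ⟩
    otherPoints P X + 1 + 1 ∸ 2                   ≡⟨ cong (_∸ 2) (+-assoc (otherPoints P X) 1 1) ⟩
    otherPoints P X + 2 ∸ 2                       ≡⟨ m+n∸n≡m (otherPoints P X) 2 ⟩
    otherPoints P X                               ∎)

  -- Double counting of the pairs (x, b) with x ≠ P a point and P, x ∈ b.
  blocksThrough₁-count : ∀ P → isPoint P ≡ true → blocksThrough₁ P * (2 ^ k ∸ 2) ≡ λ₂ * (2 ^ v ∸ 2)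
  blocksThrough₁-count P P-pt = begin
    blocksThrough₁ P * (2 ^ k ∸ 2)                         ≡⟨ cong (_* (2 ^ k ∸ 2)) (countFin≡sumFin-𝟙 N (λ b → B b P)) ⟩
    sumFin N (λ b → 𝟙 (B b P)) * (2 ^ k ∸ 2)               ≡⟨ sym (sumL-*ʳ _ _ (allFin N)) ⟩
    sumFin N (λ b → 𝟙 (B b P) * (2 ^ k ∸ 2))               ≡⟨ sumL-cong (allFin N) perBlock ⟩
    sumFin N (λ b → 𝟙 (B b P) * otherPoints P (B b))       ≡⟨ sumL-cong (allFin N) (λ b → sym (sumL-*ˡ (𝟙 (B b P)) _ (allVecs v))) ⟩
    sumFin N (λ b → sumV v (λ x → 𝟙 (B b P) * (q x * 𝟙 (B b x))))  ≡⟨ sumL-comm _ (allFin N) (allVecs v) ⟩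
    sumV v (λ x → sumFin N (λ b → 𝟙 (B b P) * (q x * 𝟙 (B b x))))  ≡⟨ sumL-cong (allVecs v) perPoint ⟩
    sumV v (λ x → λ₂ * (q x * 1))                          ≡⟨ sumL-*ˡ λ₂ _ (allVecs v) ⟩
    λ₂ * otherPoints P (λ _ → true)                        ≡⟨ cong (λ₂ *_) (otherPoints-subspace P-pt refl (refl , λ _ _ _ _ → refl)) ⟩
    λ₂ * (sumV v (λ _ → 1) ∸ 2)                            ≡⟨ cong (λ n → λ₂ * (n ∸ 2)) (sumV-one v) ⟩
    λ₂ * (2 ^ v ∸ 2)                                       ∎
    where
    q : Vect v → ℕ
    q x = 𝟙 (isPoint x ∧ not (eqV x P))
    perBlock : ∀ b → 𝟙 (B b P) * (2 ^ k ∸ 2) ≡ 𝟙 (B b P) * otherPoints P (B b)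
    perBlock b with B b P in P∈b
    ... | false = refl
    ... | true = trans (cong (λ n → 1 * (n ∸ 2)) (sym (IsSubspaceDim⇒card (B-dim b))))
                       (cong (1 *_) (sym (otherPoints-subspace P-pt P∈b (B-subspace b))))
    perPoint : ∀ x → sumFin N (λ b → 𝟙 (B b P) * (q x * 𝟙 (B b x))) ≡ λ₂ * (q x * 1)
    perPoint x with isPoint x ∧ not (eqV x P) in x≠P
    ... | false = trans (sumL-cong (allFin N) (λ b → *-zeroʳ (𝟙 (B b P)))) (trans (sumL-zero (allFin N)) (sym (*-zeroʳ λ₂)))
    ... | true = begin
      sumFin N (λ b → 𝟙 (B b P) * (𝟙 (B b x) + 0)) ≡⟨ sumL-cong (allFin N) (λ b → sym (trans (𝟙-∧ (B b P) (B b x)) (cong (𝟙 (B b P) *_) (sym (+-identityʳ _))))) ⟩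
      sumFin N (λ b → 𝟙 (B b P ∧ B b x))          ≡⟨ sym (countFin≡sumFin-𝟙 N _) ⟩
      blocksThrough₂ P x                          ≡⟨ blocksThrough₂≡λ₂ P-pt (∧-projˡ (isPoint x) _ x≠P) P≠x ⟩
      λ₂                                          ≡⟨ sym (*-identityʳ λ₂) ⟩
      λ₂ * 1                                      ∎
      where
      P≠x : eqV P x ≡ false
      P≠x = trans (eqV-sym P x) (not-injective (∧-projʳ (isPoint x) _ x≠P))

  module _ (P : Vect v) (P-pt : isPoint P ≡ true) where
    open Configurations P P-pt

    blocksThrough₃-R=S=P : ∀ {R S} → R=S=P R S ≡ true → blocksThrough₃ P R S ≡ blocksThrough₁ P
    blocksThrough₃-R=S=P {R} {S} h
      rewrite eqV⇒≡ R P (∧-projˡ (eqV R P) _ h) | eqV⇒≡ S P (∧-projʳ (eqV R P) _ h) =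
      countFin-cong N (λ b → trans (cong (B b P ∧_) (∧-idem (B b P))) (∧-idem (B b P)))

    blocksThrough₃-R=P≠S : ∀ {R S} → isPoint S ≡ true → R=P≠S R S ≡ true → blocksThrough₃ P R S ≡ λ₂
    blocksThrough₃-R=P≠S {R} {S} S-pt h rewrite eqV⇒≡ R P (∧-projˡ (eqV R P) _ h) = begin
      countFin N (λ b → B b P ∧ (B b P ∧ B b S)) ≡⟨ countFin-cong N (λ b → sym (trans (cong (_∧ B b S) (sym (∧-idem (B b P)))) (∧-assoc (B b P) _ _))) ⟩
      blocksThrough₂ P S                         ≡⟨ blocksThrough₂≡λ₂ P-pt S-pt (trans (eqV-sym P S) (not-injective (∧-projʳ (eqV R P) _ h))) ⟩
      λ₂                                         ∎

    blocksThrough₃-S=P≠R : ∀ {R S} → isPoint R ≡ true → S=P≠R R S ≡ true → blocksThrough₃ P R S ≡ λ₂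
    blocksThrough₃-S=P≠R {R} {S} R-pt h rewrite eqV⇒≡ S P (∧-projʳ (not (eqV R P)) _ h) = begin
      countFin N (λ b → B b P ∧ (B b R ∧ B b P)) ≡⟨ countFin-cong N (λ b → absorb (B b P) (B b R)) ⟩
      blocksThrough₂ P R                         ≡⟨ blocksThrough₂≡λ₂ P-pt R-pt (trans (eqV-sym P R) (not-injective (∧-projˡ (not (eqV R P)) _ h))) ⟩
      λ₂                                         ∎
      where
      absorb : ∀ a b → (a ∧ (b ∧ a)) ≡ (a ∧ b)
      absorb true b = ∧-identityʳ b
      absorb false b = refl

    blocksThrough₃-R=S≠P : ∀ {R S} → isPoint R ≡ true → R=S≠P R S ≡ true → blocksThrough₃ P R S ≡ λ₂
    blocksThrough₃-R=S≠P {R} {S} R-pt h rewrite sym (eqV⇒≡ R S (∧-projʳ (not (eqV R P)) _ h)) = begin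
      countFin N (λ b → B b P ∧ (B b R ∧ B b R)) ≡⟨ countFin-cong N (λ b → cong (B b P ∧_) (∧-idem (B b R))) ⟩
      blocksThrough₂ P R                         ≡⟨ blocksThrough₂≡λ₂ P-pt R-pt (trans (eqV-sym P R) (not-injective (∧-projˡ (not (eqV R P)) _ h))) ⟩
      λ₂                                         ∎

    blocksThrough₃-S=P+R : ∀ {R S} → isPoint R ≡ true → S=P+R R S ≡ true → blocksThrough₃ P R S ≡ λ₂
    blocksThrough₃-S=P+R {R} {S} R-pt h rewrite sym (eqV⇒≡ (P ⊕ R) S (∧-projʳ (not (eqV R P)) _ h)) = begin
      countFin N (λ b → B b P ∧ (B b R ∧ B b (P ⊕ R))) ≡⟨ countFin-cong N sumInBlock ⟩
      blocksThrough₂ P R                               ≡⟨ blocksThrough₂≡λ₂ P-pt R-pt (trans (eqV-sym P R) (not-injective (∧-projˡ (not (eqV R P)) _ h))) ⟩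
      λ₂                                               ∎
      where
      sumInBlock : ∀ b → (B b P ∧ (B b R ∧ B b (P ⊕ R))) ≡ (B b P ∧ B b R)
      sumInBlock b with B b P in P∈b | B b R in R∈b
      ... | true | true = proj₂ (B-subspace b) P R P∈b R∈b
      ... | true | false = refl
      ... | false | _ = refl

    blocksThrough₃≤λ₂ : ∀ {R S} → isPoint R ≡ true → isPoint S ≡ true → indep R S ≡ true → blocksThrough₃ P R S ≤ λ₂
    blocksThrough₃≤λ₂ {R} {S} R-pt S-pt R,S-indep = subst (blocksThrough₃ P R S ≤_)
      (blocksThrough₂≡λ₂ P-pt R-pt (trans (eqV-sym P R) R≠P)) (blocksThrough₃≤blocksThrough₂ P R S)
      where
      R≠P : eqV R P ≡ false
      R≠P = middle (eqV S P) (eqV R P) _ _ (trans (sym (indep-iff R-pt S-pt)) R,S-indep)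
        where
        middle : ∀ a b c d → (not (a ∨ (b ∨ c)) ∧ d) ≡ true → b ≡ false
        middle false false _ _ _ = refl
        middle false true _ _ ()
        middle true _ _ _ ()

prod : (ℕ → ℕ) → ℕ → ℕ
prod f zero = 1
prod f (suc d) = f d * prod f d

prod-cong : ∀ {f g : ℕ → ℕ} d → (∀ i → i < d → f i ≡ g i) → prod f d ≡ prod g d
prod-cong zero _ = refl
prod-cong (suc d) f≗g = cong₂ _*_ (f≗g d ≤-refl) (prod-cong d (λ i i<d → f≗g i (m≤n⇒m≤1+n i<d)))

prod-suc : ∀ f d → prod f (suc d) ≡ f 0 * prod (f ∘ suc) d
prod-suc f zero = refl
prod-suc f (suc d) = begin
  f (suc d) * (f d * prod f d)         ≡⟨ cong (f (suc d) *_) (prod-suc f d) ⟩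
  f (suc d) * (f 0 * prod (f ∘ suc) d) ≡⟨ x*[y*z]≡y*[x*z] (f (suc d)) (f 0) _ ⟩
  f 0 * (f (suc d) * prod (f ∘ suc) d) ∎

prod-* : ∀ f g d → prod (λ i → f i * g i) d ≡ prod f d * prod g d
prod-* f g zero = refl
prod-* f g (suc d) = trans (cong (f d * g d *_) (prod-* f g d)) (*-*-interchange (f d) (g d) (prod f d) (prod g d))

prod-reverse : ∀ f d → prod f d ≡ prod (λ i → f (d ∸ suc i)) d
prod-reverse f zero = refl
prod-reverse f (suc d) = begin
  f d * prod f d                       ≡⟨ cong (f d *_) (prod-reverse f d) ⟩
  f d * prod (λ i → f (d ∸ suc i)) d   ≡⟨ sym (prod-suc (λ i → f (suc d ∸ suc i)) d) ⟩
  prod (λ i → f (suc d ∸ suc i)) (suc d) ∎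

prod-pos : ∀ f d → (∀ i → 0 < f i) → 0 < prod f d
prod-pos f zero _ = s≤s z≤n
prod-pos f (suc d) f>0 = m*n>0 (f>0 d) (prod-pos f d f>0)
  where
  m*n>0 : ∀ {m n} → 0 < m → 0 < n → 0 < m * n
  m*n>0 {suc m} {suc n} _ _ = s≤s z≤n

gnum≡prod : ∀ a d → gnum a d ≡ prod (λ i → 2 ^ (a ∸ i) ∸ 1) d
gnum≡prod a zero = refl
gnum≡prod a (suc d) = cong ((2 ^ (a ∸ d) ∸ 1) *_) (gnum≡prod a d)

gden≡prod : ∀ d → gden d ≡ prod (λ i → 2 ^ suc i ∸ 1) d
gden≡prod zero = refl
gden≡prod (suc d) = cong ((2 ^ suc d ∸ 1) *_) (gden≡prod d)

-- The number of ways to extend n independent vectors of F₂^V by d further vectors to an independent family.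
extensions : ℕ → ℕ → ℕ → ℕ
extensions V n zero = 1
extensions V n (suc d) = (2 ^ V ∸ 2 ^ n) * extensions V (suc n) d

extensions≡prod : ∀ V n d → extensions V n d ≡ prod (λ i → 2 ^ V ∸ 2 ^ (n + i)) d
extensions≡prod V n zero = refl
extensions≡prod V n (suc d) = begin
  (2 ^ V ∸ 2 ^ n) * extensions V (suc n) d
    ≡⟨ cong₂ _*_ (cong (λ t → 2 ^ V ∸ 2 ^ t) (sym (+-identityʳ n))) (extensions≡prod V (suc n) d) ⟩
  (2 ^ V ∸ 2 ^ (n + 0)) * prod (λ i → 2 ^ V ∸ 2 ^ (suc n + i)) d
    ≡⟨ cong ((2 ^ V ∸ 2 ^ (n + 0)) *_) (prod-cong d (λ i _ → cong (λ t → 2 ^ V ∸ 2 ^ t) (sym (+-suc n i)))) ⟩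
  (2 ^ V ∸ 2 ^ (n + 0)) * prod (λ i → 2 ^ V ∸ 2 ^ (n + suc i)) d
    ≡⟨ sym (prod-suc (λ i → 2 ^ V ∸ 2 ^ (n + i)) d) ⟩
  prod (λ i → 2 ^ V ∸ 2 ^ (n + i)) (suc d) ∎

2^V∸2^j : ∀ V j → j ≤ V → 2 ^ V ∸ 2 ^ j ≡ 2 ^ j * (2 ^ (V ∸ j) ∸ 1)
2^V∸2^j V j j≤V = sym (begin
  2 ^ j * (2 ^ (V ∸ j) ∸ 1)       ≡⟨ *-distribˡ-∸ (2 ^ j) (2 ^ (V ∸ j)) 1 ⟩
  2 ^ j * 2 ^ (V ∸ j) ∸ 2 ^ j * 1 ≡⟨ cong₂ _∸_ (sym (^-distribˡ-+-* 2 j (V ∸ j))) (*-identityʳ (2 ^ j)) ⟩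
  2 ^ (j + (V ∸ j)) ∸ 2 ^ j       ≡⟨ cong (λ t → 2 ^ t ∸ 2 ^ j) (m+[n∸m]≡n j≤V) ⟩
  2 ^ V ∸ 2 ^ j                   ∎)

powers : ℕ → ℕ
powers d = prod (λ i → 2 ^ (3 + i)) d

extensions-from-3 : ∀ v d → 3 + d ≤ v → extensions v 3 d ≡ powers d * gnum (v ∸ 3) d
extensions-from-3 v d 3+d≤v = begin
  extensions v 3 d                                     ≡⟨ extensions≡prod v 3 d ⟩
  prod (λ i → 2 ^ v ∸ 2 ^ (3 + i)) d
    ≡⟨ prod-cong d (λ i i<d → trans (2^V∸2^j v (3 + i) (≤-trans (+-monoʳ-≤ 3 (<⇒≤ i<d)) 3+d≤v))
                                     (cong (λ t → 2 ^ (3 + i) * (2 ^ t ∸ 1)) (sym (∸-+-assoc v 3 i)))) ⟩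
  prod (λ i → 2 ^ (3 + i) * (2 ^ (v ∸ 3 ∸ i) ∸ 1)) d   ≡⟨ prod-* _ _ d ⟩
  powers d * prod (λ i → 2 ^ (v ∸ 3 ∸ i) ∸ 1) d        ≡⟨ cong (powers d *_) (sym (gnum≡prod (v ∸ 3) d)) ⟩
  powers d * gnum (v ∸ 3) d                            ∎

extensions-within-3+d : ∀ d → extensions (3 + d) 3 d ≡ powers d * gden d
extensions-within-3+d d = begin
  extensions (3 + d) 3 d                             ≡⟨ extensions≡prod (3 + d) 3 d ⟩
  prod (λ i → 2 ^ (3 + d) ∸ 2 ^ (3 + i)) d
    ≡⟨ prod-cong d (λ i i<d → 2^V∸2^j (3 + d) (3 + i) (+-monoʳ-≤ 3 (<⇒≤ i<d))) ⟩
  prod (λ i → 2 ^ (3 + i) * (2 ^ (d ∸ i) ∸ 1)) d     ≡⟨ prod-* _ _ d ⟩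
  powers d * prod (λ i → 2 ^ (d ∸ i) ∸ 1) d          ≡⟨ cong (powers d *_) (prod-reverse _ d) ⟩
  powers d * prod (λ i → 2 ^ (d ∸ (d ∸ suc i)) ∸ 1) d
    ≡⟨ cong (powers d *_) (prod-cong d (λ i i<d → cong (λ t → 2 ^ t ∸ 1) (m∸[m∸n]≡n i<d))) ⟩
  powers d * prod (λ i → 2 ^ suc i ∸ 1) d            ≡⟨ cong (powers d *_) (sym (gden≡prod d)) ⟩
  powers d * gden d                                  ∎

≤gauss : ∀ v d c → 3 + d ≤ v → c * extensions (3 + d) 3 d ≤ extensions v 3 d → c ≤ gauss (v ∸ 3) d
≤gauss v d c 3+d≤v c*e≤e = subst (_≤ gauss (v ∸ 3) d) (m*n/n≡m c (gden d) {{gden-nz d}})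
  (/-monoˡ-≤ (gden d) {{gden-nz d}} c*gden≤gnum)
  where
  instance
    powers-nonZero : NonZero (powers d)
    powers-nonZero = >-nonZero (prod-pos _ d (λ i → m^n>0 2 (3 + i)))
  c*gden≤gnum : c * gden d ≤ gnum (v ∸ 3) d
  c*gden≤gnum = *-cancelˡ-≤ (powers d) (subst₂ _≤_
    (trans (cong (c *_) (extensions-within-3+d d)) (x*[y*z]≡y*[x*z] c (powers d) (gden d)))
    (extensions-from-3 v d 3+d≤v) c*e≤e)

-- Distinct k-subspaces through a 3-space

module DistinctSubspaces {v k N : ℕ} (B : Fin N → SubsetV v)
  (B-dim : ∀ b → IsSubspaceDim k (B b))
  (B-inj : ∀ b b′ → (∀ x → B b x ≡ B b′ x) → b ≡ b′) where

  -- Ordered families x₁, …, x_d in B β, each outside the span of Ls and the previous ones, that span B β together with Ls.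
  completions : Fin N → List (Vect v) → ℕ → ℕ
  completions β Ls zero = 𝟙 (subsetB (B β) (spanL Ls) ∧ subsetB (spanL Ls) (B β))
  completions β Ls (suc d) = sumV v (λ x → 𝟙 (not (spanL Ls x) ∧ B β x) * completions β (x ∷ Ls) d)

  independent-∷ : ∀ (Ls : List (Vect v)) x → dimSpan Ls ≡ length Ls → spanL Ls x ≡ false →
    dimSpan (x ∷ Ls) ≡ length (x ∷ Ls)
  independent-∷ Ls x indep x∉ rewrite x∉ = cong suc indep

  card-complement : ∀ {U : SubsetV v} → card (not ∘ U) + card U ≡ 2 ^ v
  card-complement {U} = begin
    card (not ∘ U) + card U                   ≡⟨ cong (_+ card U) (sumL-cong (allVecs v) (λ x → cong 𝟙 (sym (∧-identityʳ _)))) ⟩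
    card (λ x → not (U x) ∧ true) + card U    ≡⟨ card-difference {v} {U} {λ _ → true} (λ _ _ → refl) ⟩
    sumV v (λ _ → 1)                          ≡⟨ sumV-one v ⟩
    2 ^ v                                     ∎

  sum-completions≤extensions : ∀ d (Ls : List (Vect v)) → dimSpan Ls ≡ length Ls →
    sumFin N (λ β → completions β Ls d) ≤ extensions v (length Ls) d
  sum-completions≤extensions zero Ls _ = subst (_≤ 1) (countFin≡sumFin-𝟙 N _) (countFin-unique N _ spansOne)
    where
    spansOne : ∀ β β′ → (subsetB (B β) (spanL Ls) ∧ subsetB (spanL Ls) (B β)) ≡ true →
      (subsetB (B β′) (spanL Ls) ∧ subsetB (spanL Ls) (B β′)) ≡ true → β ≡ β′
    spansOne β β′ e e′ = B-inj β β′ (λ x → ⇔→≡ (mk⇔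
      (λ x∈β → subsetB⇒⊆ (spanL Ls) (B β′) (∧-projʳ (subsetB (B β′) _) _ e′) x
                 (subsetB⇒⊆ (B β) (spanL Ls) (∧-projˡ _ (subsetB (spanL Ls) (B β)) e) x x∈β))
      (λ x∈β′ → subsetB⇒⊆ (spanL Ls) (B β) (∧-projʳ (subsetB (B β) _) _ e) x
                  (subsetB⇒⊆ (B β′) (spanL Ls) (∧-projˡ _ (subsetB (spanL Ls) (B β′)) e′) x x∈β′))))
  sum-completions≤extensions (suc d) Ls indep =
    subst₂ _≤_ (sym (sumL-comm _ (allFin N) (allVecs v))) total (sumL-mono (allVecs v) perVector)
    where
    perVector : ∀ x → sumFin N (λ β → 𝟙 (not (spanL Ls x) ∧ B β x) * completions β (x ∷ Ls) d)
                    ≤ 𝟙 (not (spanL Ls x)) * extensions v (suc (length Ls)) d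
    perVector x with spanL Ls x in x∉
    ... | true = ≤-reflexive (sumL-zero (allFin N))
    ... | false = ≤-trans (sumL-mono (allFin N) (λ β → 𝟙*-≤ (B β x) _))
                          (subst (sumFin N (λ β → completions β (x ∷ Ls) d) ≤_) (sym (*-identityˡ _)) (sum-completions≤extensions d (x ∷ Ls) (independent-∷ Ls x indep x∉)))
    |complement| : card (not ∘ spanL Ls) ≡ 2 ^ v ∸ 2 ^ length Ls
    |complement| = begin
      card (not ∘ spanL Ls)                        ≡⟨ sym (m+n∸n≡m _ (card (spanL Ls))) ⟩
      card (not ∘ spanL Ls) + card (spanL Ls) ∸ card (spanL Ls)
        ≡⟨ cong₂ _∸_ card-complement (trans (card-span Ls) (cong (2 ^_) indep)) ⟩
      2 ^ v ∸ 2 ^ length Ls                        ∎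
    total : sumV v (λ x → 𝟙 (not (spanL Ls x)) * extensions v (suc (length Ls)) d)
          ≡ (2 ^ v ∸ 2 ^ length Ls) * extensions v (suc (length Ls)) d
    total = trans (sumL-*ʳ _ _ (allVecs v)) (cong (_* extensions v (suc (length Ls)) d) |complement|)

  completions-exact : ∀ d β (Ls : List (Vect v)) → dimSpan Ls ≡ length Ls → spanL Ls ⊆ B β →
    length Ls + d ≡ k → completions β Ls d ≡ extensions k (length Ls) d
  completions-exact zero β Ls indep Ls⊆β |Ls|≡k = cong 𝟙 (∧-intro (⊆⇒subsetB β⊆Ls) (⊆⇒subsetB Ls⊆β))
    where
    β⊆Ls : B β ⊆ spanL Ls
    β⊆Ls = ⊆-card-reverse Ls⊆β (≤-reflexive (begin
      card (B β)          ≡⟨ IsSubspaceDim⇒card (B-dim β) ⟩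
      2 ^ k               ≡⟨ cong (2 ^_) (sym (trans (sym (+-identityʳ _)) |Ls|≡k)) ⟩
      2 ^ length Ls       ≡⟨ cong (2 ^_) (sym indep) ⟩
      2 ^ dimSpan Ls      ≡⟨ sym (card-span Ls) ⟩
      card (spanL Ls)     ∎))
  completions-exact (suc d) β Ls indep Ls⊆β |Ls|+d≡k = begin
    sumV v (λ x → 𝟙 (not (spanL Ls x) ∧ B β x) * completions β (x ∷ Ls) d)
      ≡⟨ sumL-cong (allVecs v) extend ⟩
    sumV v (λ x → 𝟙 (not (spanL Ls x) ∧ B β x) * extensions k (suc (length Ls)) d)
      ≡⟨ sumL-*ʳ _ _ (allVecs v) ⟩
    card (λ x → not (spanL Ls x) ∧ B β x) * extensions k (suc (length Ls)) d
      ≡⟨ cong (_* extensions k (suc (length Ls)) d) |β∖Ls| ⟩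
    (2 ^ k ∸ 2 ^ length Ls) * extensions k (suc (length Ls)) d ∎
    where
    β-subspace : IsSubspace (B β)
    β-subspace = IsSubspaceDim⇒IsSubspace (B-dim β)
    x∷Ls⊆β : ∀ {x} → B β x ≡ true → spanL (x ∷ Ls) ⊆ B β
    x∷Ls⊆β {x} x∈β y y∈ = ∨-elim _ _ y∈ (Ls⊆β y)
      (λ y+x∈ → subst (λ z → B β z ≡ true) (⊕-cancelʳ y x) (proj₂ β-subspace (y ⊕ x) x (Ls⊆β (y ⊕ x) y+x∈) x∈β))
    extend : ∀ x → 𝟙 (not (spanL Ls x) ∧ B β x) * completions β (x ∷ Ls) d
                 ≡ 𝟙 (not (spanL Ls x) ∧ B β x) * extensions k (suc (length Ls)) d
    extend x with spanL Ls x in x∉ | B β x in x∈β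
    ... | true | _ = refl
    ... | false | false = refl
    ... | false | true = cong (1 *_) (completions-exact d β (x ∷ Ls) (independent-∷ Ls x indep x∉) (x∷Ls⊆β x∈β)
                                        (trans (sym (+-suc _ d)) |Ls|+d≡k))
    |β∖Ls| : card (λ x → not (spanL Ls x) ∧ B β x) ≡ 2 ^ k ∸ 2 ^ length Ls
    |β∖Ls| = begin
      card (λ x → not (spanL Ls x) ∧ B β x)         ≡⟨ sym (m+n∸n≡m _ (card (spanL Ls))) ⟩
      card (λ x → not (spanL Ls x) ∧ B β x) + card (spanL Ls) ∸ card (spanL Ls)
        ≡⟨ cong₂ _∸_ (trans (card-difference Ls⊆β) (IsSubspaceDim⇒card (B-dim β))) (trans (card-span Ls) (cong (2 ^_) indep)) ⟩
      2 ^ k ∸ 2 ^ length Ls                         ∎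

  module _ {P R S : Vect v} (indep : dimSpan (P ∷ R ∷ S ∷ []) ≡ 3) where

    through : Fin N → Bool
    through β = B β P ∧ (B β R ∧ B β S)

    span⊆through : ∀ β → through β ≡ true → spanL (P ∷ R ∷ S ∷ []) ⊆ B β
    span⊆through β e = span-least (IsSubspaceDim⇒IsSubspace (B-dim β)) (P ∷ R ∷ S ∷ [])
      (trans (cong (λ c → B β P ∧ (B β R ∧ c)) (∧-identityʳ (B β S))) e)

    -- Each block through ⟨P,R,S⟩ has extensions k 3 (k-3) ordered completions of (P,R,S) to a basis,
    -- while all blocks together have at most extensions v 3 (k-3).
    countThrough≤gauss : ∀ d → 3 + d ≡ k → 3 + d ≤ v → countFin N through ≤ gauss (v ∸ 3) d
    countThrough≤gauss d 3+d≡k 3+d≤v = ≤gauss v d (countFin N through) 3+d≤v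
      (subst (_≤ extensions v 3 d) (sym perBlock)
        (≤-trans (sumL-mono (allFin N) (λ β → 𝟙*-≤ (through β) _)) (sum-completions≤extensions d (P ∷ R ∷ S ∷ []) indep)))
      where
      exact : ∀ β → 𝟙 (through β) * extensions (3 + d) 3 d ≡ 𝟙 (through β) * completions β (P ∷ R ∷ S ∷ []) d
      exact β with through β in e
      ... | false = refl
      ... | true = trans (cong (λ n → 1 * extensions n 3 d) 3+d≡k)
                         (cong (1 *_) (sym (completions-exact d β (P ∷ R ∷ S ∷ []) indep (span⊆through β e) 3+d≡k)))
      perBlock : countFin N through * extensions (3 + d) 3 d ≡ sumFin N (λ β → 𝟙 (through β) * completions β (P ∷ R ∷ S ∷ []) d)
      perBlock = begin
        countFin N through * extensions (3 + d) 3 d              ≡⟨ cong (_* extensions (3 + d) 3 d) (countFin≡sumFin-𝟙 N through) ⟩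
        sumFin N (𝟙 ∘ through) * extensions (3 + d) 3 d          ≡⟨ sym (sumL-*ʳ _ _ (allFin N)) ⟩
        sumFin N (λ β → 𝟙 (through β) * extensions (3 + d) 3 d)  ≡⟨ sumL-cong (allFin N) exact ⟩
        sumFin N (λ β → 𝟙 (through β) * completions β (P ∷ R ∷ S ∷ []) d) ∎

    countThrough-small : k ≤ 2 → countFin N through ≡ 0
    countThrough-small k≤2 = countFin-none N none
      where
      none : ∀ β → through β ≡ false
      none β with through β in e
      ... | false = refl
      ... | true = ⊥-elim (<⇒≱ 2^k<8 8≤2^k)
        where
        2^k<8 : 2 ^ k < 8
        2^k<8 = s≤s (≤-trans (^-monoʳ-≤ 2 k≤2) (s≤s (s≤s (s≤s (s≤s z≤n)))))
        8≤2^k : 8 ≤ 2 ^ k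
        8≤2^k = subst₂ _≤_ (trans (card-span (P ∷ R ∷ S ∷ [])) (cong (2 ^_) indep)) (IsSubspaceDim⇒card (B-dim β))
                  (sumL-mono (allVecs v) (λ y → 𝟙-mono (span⊆through β e y)))

    countThrough≤gaussVK3 : k ≤ v → countFin N through ≤ gaussVK3 v k
    countThrough≤gaussVK3 k≤v with k <ᵇ 3 in k<ᵇ3
    ... | true = ≤-reflexive (countThrough-small (≤-pred (<ᵇ⇒< k 3 (subst T (sym k<ᵇ3) tt))))
    ... | false = countThrough≤gauss (k ∸ 3) (m+[n∸m]≡n 3≤k) (subst (_≤ v) (sym (m+[n∸m]≡n 3≤k)) k≤v)
      where
      3≤k : 3 ≤ k
      3≤k = ≮⇒≥ (λ k<3 → subst T k<ᵇ3 (<⇒<ᵇ k<3))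

-- Pairs of points from two point classes

module PairCount {v k λ₂ N m : ℕ} (B : Fin N → SubsetV v)
  (B-dim : ∀ b → IsSubspaceDim k (B b))
  (B-λ₂ : ∀ U → IsSubspaceDim 2 U → countFin N (λ b → subsetB U (B b)) ≡ λ₂)
  (P : Vect v) (P-pt : isPoint P ≡ true) (po : Vect v → Fin m) (r s : Fin m) where

  open Design B B-dim B-λ₂
  open Configurations P P-pt

  inΨ : Fin m → Vect v → ℕ
  inΨ i x = 𝟙 (isPoint x ∧ isIn (po x) i)

  weight : Vect v → Vect v → ℕ
  weight R S = inΨ r R * inΨ s S

  ΣΨ : (Vect v → Vect v → ℕ) → ℕ
  ΣΨ F = sumV v (λ R → sumV v (λ S → weight R S * F R S))

  ΣΨ-cong : ∀ {F G} → (∀ {R S} → isPoint R ≡ true → isPoint S ≡ true → F R S ≡ G R S) → ΣΨ F ≡ ΣΨ G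
  ΣΨ-cong {F} {G} F≗G = sumL-cong (allVecs v) (λ R → sumL-cong (allVecs v) (λ S → weighted R S))
    where
    weighted : ∀ R S → weight R S * F R S ≡ weight R S * G R S
    weighted R S with isPoint R in R-pt | isPoint S in S-pt
    ... | true | true = cong (𝟙 (isIn (po R) r) * 𝟙 (isIn (po S) s) *_) (F≗G R-pt S-pt)
    ... | true | false rewrite *-zeroʳ (𝟙 (isIn (po R) r)) = refl
    ... | false | _ = refl

  ΣΨ-mono : ∀ {F G} → (∀ {R S} → isPoint R ≡ true → isPoint S ≡ true → F R S ≤ G R S) → ΣΨ F ≤ ΣΨ G
  ΣΨ-mono {F} {G} F≤G = sumL-mono (allVecs v) (λ R → sumL-mono (allVecs v) (λ S → weighted R S))
    where
    weighted : ∀ R S → weight R S * F R S ≤ weight R S * G R S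
    weighted R S with isPoint R in R-pt | isPoint S in S-pt
    ... | true | true = *-monoʳ-≤ (𝟙 (isIn (po R) r) * 𝟙 (isIn (po S) s)) (F≤G R-pt S-pt)
    ... | true | false rewrite *-zeroʳ (𝟙 (isIn (po R) r)) = z≤n
    ... | false | _ = z≤n

  ΣΨ-+ : ∀ F G → ΣΨ (λ R S → F R S + G R S) ≡ ΣΨ F + ΣΨ G
  ΣΨ-+ F G = trans (sumL-cong (allVecs v) (λ R → trans (sumL-cong (allVecs v) (λ S → *-distribˡ-+ (weight R S) (F R S) (G R S)))
                                                       (sumL-+ _ _ (allVecs v))))
                   (sumL-+ _ _ (allVecs v))

  ΣΨ-*ˡ : ∀ c F → ΣΨ (λ R S → c * F R S) ≡ c * ΣΨ F
  ΣΨ-*ˡ c F = trans (sumL-cong (allVecs v) (λ R → trans (sumL-cong (allVecs v) (λ S → x*[y*z]≡y*[x*z] (weight R S) c (F R S)))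
                                                        (sumL-*ˡ c _ (allVecs v))))
                    (sumL-*ˡ c _ (allVecs v))

  kappaB≡sumV : ∀ i (X : SubsetV v) → kappaB po i X ≡ sumV v (λ x → inΨ i x * 𝟙 (X x))
  kappaB≡sumV i X = trans (countL≡sumL-𝟙 _ (allVecs v)) (sumL-cong (allVecs v) (λ x → regroup (isPoint x) (isIn (po x) i) (X x)))
    where
    regroup : ∀ p q z → 𝟙 (p ∧ (q ∧ z)) ≡ 𝟙 (p ∧ q) * 𝟙 z
    regroup p q z = trans (cong 𝟙 (sym (∧-assoc p q z))) (𝟙-∧ (p ∧ q) z)

  blocksSum : ℕ
  blocksSum = sumFin N (λ β → 𝟙 (B β P) * kappaB po r (B β) * kappaB po s (B β))

  blocksSum≡ΣΨ : blocksSum ≡ ΣΨ (blocksThrough₃ P)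
  blocksSum≡ΣΨ = begin
    blocksSum
      ≡⟨ sumL-cong (allFin N) expand ⟩
    sumFin N (λ β → sumV v (λ R → sumV v (λ S → term β R S)))
      ≡⟨ sumL-comm _ (allFin N) (allVecs v) ⟩
    sumV v (λ R → sumFin N (λ β → sumV v (λ S → term β R S)))
      ≡⟨ sumL-cong (allVecs v) (λ R → sumL-comm _ (allFin N) (allVecs v)) ⟩
    sumV v (λ R → sumV v (λ S → sumFin N (λ β → term β R S)))
      ≡⟨ sumL-cong (allVecs v) (λ R → sumL-cong (allVecs v) (λ S → countBlocks R S)) ⟩
    ΣΨ (blocksThrough₃ P) ∎
    where
    term : Fin N → Vect v → Vect v → ℕ
    term β R S = 𝟙 (B β P) * (inΨ r R * 𝟙 (B β R) * (inΨ s S * 𝟙 (B β S)))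
    expand : ∀ β → 𝟙 (B β P) * kappaB po r (B β) * kappaB po s (B β) ≡ sumV v (λ R → sumV v (λ S → term β R S))
    expand β = begin
      𝟙 (B β P) * kappaB po r (B β) * kappaB po s (B β)
        ≡⟨ *-assoc (𝟙 (B β P)) _ _ ⟩
      𝟙 (B β P) * (kappaB po r (B β) * kappaB po s (B β))
        ≡⟨ cong (𝟙 (B β P) *_) (cong₂ _*_ (kappaB≡sumV r (B β)) (kappaB≡sumV s (B β))) ⟩
      𝟙 (B β P) * (sumV v (λ R → inΨ r R * 𝟙 (B β R)) * sumV v (λ S → inΨ s S * 𝟙 (B β S)))
        ≡⟨ cong (𝟙 (B β P) *_) (sumL-*-sumL _ _ (allVecs v) (allVecs v)) ⟩
      𝟙 (B β P) * sumV v (λ R → sumV v (λ S → inΨ r R * 𝟙 (B β R) * (inΨ s S * 𝟙 (B β S))))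
        ≡⟨ sym (sumL-*ˡ (𝟙 (B β P)) _ (allVecs v)) ⟩
      sumV v (λ R → 𝟙 (B β P) * sumV v (λ S → inΨ r R * 𝟙 (B β R) * (inΨ s S * 𝟙 (B β S))))
        ≡⟨ sumL-cong (allVecs v) (λ R → sym (sumL-*ˡ (𝟙 (B β P)) _ (allVecs v))) ⟩
      sumV v (λ R → sumV v (λ S → term β R S)) ∎
    rearrange : ∀ p a x b y → p * (a * x * (b * y)) ≡ a * b * (p * (x * y))
    rearrange = solve-∀
    countBlocks : ∀ R S → sumFin N (λ β → term β R S) ≡ weight R S * blocksThrough₃ P R S
    countBlocks R S = begin
      sumFin N (λ β → term β R S)
        ≡⟨ sumL-cong (allFin N) (λ β → rearrange (𝟙 (B β P)) (inΨ r R) (𝟙 (B β R)) (inΨ s S) (𝟙 (B β S))) ⟩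
      sumFin N (λ β → weight R S * (𝟙 (B β P) * (𝟙 (B β R) * 𝟙 (B β S))))
        ≡⟨ sumL-*ˡ (weight R S) _ (allFin N) ⟩
      weight R S * sumFin N (λ β → 𝟙 (B β P) * (𝟙 (B β R) * 𝟙 (B β S)))
        ≡⟨ cong (weight R S *_) (sumL-cong (allFin N) (λ β → sym (𝟙-∧∧ (B β P) (B β R) (B β S)))) ⟩
      weight R S * sumFin N (λ β → 𝟙 (B β P ∧ (B β R ∧ B β S)))
        ≡⟨ cong (weight R S *_) (sym (countFin≡sumFin-𝟙 N _)) ⟩
      weight R S * blocksThrough₃ P R S ∎
      where
      𝟙-∧∧ : ∀ a b c → 𝟙 (a ∧ (b ∧ c)) ≡ 𝟙 a * (𝟙 b * 𝟙 c)
      𝟙-∧∧ a b c = trans (𝟙-∧ a (b ∧ c)) (cong (𝟙 a *_) (𝟙-∧ b c))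

  spanning onLine inPlane : Vect v → Vect v → ℕ
  spanning R S = 𝟙 (indep R S)
  onLine R S = 𝟙 (R=S=P R S)
  inPlane R S = 𝟙 (R=P≠S R S) + (𝟙 (S=P≠R R S) + (𝟙 (R=S≠P R S) + 𝟙 (S=P+R R S)))

  x*0*y≡0 : ∀ x y → x * 0 * y ≡ 0
  x*0*y≡0 x y = cong (_* y) (*-zeroʳ x)

  *𝟙-cong : ∀ {b x y} → (b ≡ true → x ≡ y) → x * 𝟙 b ≡ y * 𝟙 b
  *𝟙-cong {true} x≡y = cong (_* 1) (x≡y refl)
  *𝟙-cong {false} {x} {y} _ = trans (*-zeroʳ x) (sym (*-zeroʳ y))

  blocksThrough₃-split : ∀ {R S} → isPoint R ≡ true → isPoint S ≡ true →
    blocksThrough₃ P R S ≡ blocksThrough₃ P R S * spanning R S + (blocksThrough₁ P * onLine R S + λ₂ * inPlane R S)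
  blocksThrough₃-split {R} {S} R-pt S-pt = begin
    c                                                                 ≡⟨ sym (*-identityʳ c) ⟩
    c * 1                                                             ≡⟨ cong (c *_) (sym (partition R-pt S-pt)) ⟩
    c * (spanning R S + (onLine R S + (i₂ + (i₃ + (i₄ + i₅)))))      ≡⟨ distribute c (spanning R S) (onLine R S) i₂ i₃ i₄ i₅ ⟩
    c * spanning R S + (c * onLine R S + (c * i₂ + (c * i₃ + (c * i₄ + c * i₅))))
      ≡⟨ cong (c * spanning R S +_) (cong₂ _+_ (*𝟙-cong (blocksThrough₃-R=S=P P P-pt))
           (cong₂ _+_ (*𝟙-cong (blocksThrough₃-R=P≠S P P-pt S-pt)) (cong₂ _+_ (*𝟙-cong (blocksThrough₃-S=P≠R P P-pt R-pt))
             (cong₂ _+_ (*𝟙-cong (blocksThrough₃-R=S≠P P P-pt R-pt)) (*𝟙-cong (blocksThrough₃-S=P+R P P-pt R-pt)))))) ⟩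
    c * spanning R S + (blocksThrough₁ P * onLine R S + (λ₂ * i₂ + (λ₂ * i₃ + (λ₂ * i₄ + λ₂ * i₅))))
      ≡⟨ cong (λ t → c * spanning R S + (blocksThrough₁ P * onLine R S + t)) (factor λ₂ i₂ i₃ i₄ i₅) ⟩
    c * spanning R S + (blocksThrough₁ P * onLine R S + λ₂ * inPlane R S) ∎
    where
    c i₂ i₃ i₄ i₅ : ℕ
    c = blocksThrough₃ P R S
    i₂ = 𝟙 (R=P≠S R S)
    i₃ = 𝟙 (S=P≠R R S)
    i₄ = 𝟙 (R=S≠P R S)
    i₅ = 𝟙 (S=P+R R S)
    distribute : ∀ c x y a b d e → c * (x + (y + (a + (b + (d + e))))) ≡ c * x + (c * y + (c * a + (c * b + (c * d + c * e))))
    distribute = solve-∀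
    factor : ∀ l a b d e → l * a + (l * b + (l * d + l * e)) ≡ l * (a + (b + (d + e)))
    factor = solve-∀

  Φ : ℕ
  Φ = ΣΨ (λ R S → blocksThrough₃ P R S * spanning R S)

  blocksSum-byConfiguration : blocksSum ≡ Φ + (blocksThrough₁ P * ΣΨ onLine + λ₂ * ΣΨ inPlane)
  blocksSum-byConfiguration = begin
    blocksSum              ≡⟨ blocksSum≡ΣΨ ⟩
    ΣΨ (blocksThrough₃ P)  ≡⟨ ΣΨ-cong blocksThrough₃-split ⟩
    ΣΨ (λ R S → blocksThrough₃ P R S * spanning R S + (blocksThrough₁ P * onLine R S + λ₂ * inPlane R S))
      ≡⟨ trans (ΣΨ-+ _ _) (cong (Φ +_) (trans (ΣΨ-+ _ _) (cong₂ _+_ (ΣΨ-*ˡ (blocksThrough₁ P) onLine) (ΣΨ-*ˡ λ₂ inPlane)))) ⟩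
    Φ + (blocksThrough₁ P * ΣΨ onLine + λ₂ * ΣΨ inPlane) ∎

  pairs-byConfiguration : ΣΨ (λ _ _ → 1) ≡ ΣΨ spanning + (ΣΨ onLine + ΣΨ inPlane)
  pairs-byConfiguration = trans (ΣΨ-cong (λ R-pt S-pt → sym (partition R-pt S-pt)))
                      (trans (ΣΨ-+ _ _) (cong (ΣΨ spanning +_) (ΣΨ-+ onLine inPlane)))

  ΣΨ-∧ : ∀ (X : Vect v → Bool) (Y : Vect v → Vect v → Bool) →
    ΣΨ (λ R S → 𝟙 (X R ∧ Y R S)) ≡ sumV v (λ R → 𝟙 (X R) * inΨ r R * sumV v (λ S → 𝟙 (Y R S) * inΨ s S))
  ΣΨ-∧ X Y = sumL-cong (allVecs v) (λ R → trans (sumL-cong (allVecs v) (λ S →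
      trans (cong (weight R S *_) (𝟙-∧ (X R) (Y R S))) (rearrange (inΨ r R) (inΨ s S) (𝟙 (X R)) (𝟙 (Y R S)))))
    (sumL-*ˡ (𝟙 (X R) * inΨ r R) _ (allVecs v)))
    where
    rearrange : ∀ a b x y → a * b * (x * y) ≡ x * a * (y * b)
    rearrange = solve-∀

  Ψ∖P : Fin m → ℕ
  Ψ∖P i = sumV v (λ R → 𝟙 (not (eqV R P)) * inΨ i R)

  Ψr∩Ψs∖P : ℕ
  Ψr∩Ψs∖P = sumV v (λ R → 𝟙 (not (eqV R P)) * inΨ r R * inΨ s R)

  orbSize-split : ∀ i → orbSize po i ≡ Ψ∖P i + inΨ i P
  orbSize-split i = trans (countL≡sumL-𝟙 _ (allVecs v)) (sumV-split (inΨ i) P)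

  ΣΨ-onLine : ΣΨ onLine ≡ inΨ r P * inΨ s P
  ΣΨ-onLine = begin
    ΣΨ onLine                                                          ≡⟨ ΣΨ-∧ (λ R → eqV R P) (λ _ S → eqV S P) ⟩
    sumV v (λ R → 𝟙 (eqV R P) * inΨ r R * sumV v (λ S → 𝟙 (eqV S P) * inΨ s S))
      ≡⟨ sumL-cong (allVecs v) (λ R → trans (cong (𝟙 (eqV R P) * inΨ r R *_) (sumV-pointMass (inΨ s) P)) (*-assoc (𝟙 (eqV R P)) (inΨ r R) (inΨ s P))) ⟩
    sumV v (λ R → 𝟙 (eqV R P) * (inΨ r R * inΨ s P))                   ≡⟨ sumV-pointMass (λ R → inΨ r R * inΨ s P) P ⟩
    inΨ r P * inΨ s P                                                  ∎

  ΣΨ-R=P≠S : ΣΨ (λ R S → 𝟙 (R=P≠S R S)) ≡ inΨ r P * Ψ∖P s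
  ΣΨ-R=P≠S = begin
    ΣΨ (λ R S → 𝟙 (R=P≠S R S))                        ≡⟨ ΣΨ-∧ (λ R → eqV R P) (λ _ S → not (eqV S P)) ⟩
    sumV v (λ R → 𝟙 (eqV R P) * inΨ r R * Ψ∖P s)      ≡⟨ sumL-cong (allVecs v) (λ R → *-assoc (𝟙 (eqV R P)) (inΨ r R) (Ψ∖P s)) ⟩
    sumV v (λ R → 𝟙 (eqV R P) * (inΨ r R * Ψ∖P s))    ≡⟨ sumV-pointMass (λ R → inΨ r R * Ψ∖P s) P ⟩
    inΨ r P * Ψ∖P s                                   ∎

  ΣΨ-S=P≠R : ΣΨ (λ R S → 𝟙 (S=P≠R R S)) ≡ Ψ∖P r * inΨ s P
  ΣΨ-S=P≠R = begin
    ΣΨ (λ R S → 𝟙 (S=P≠R R S))                                           ≡⟨ ΣΨ-∧ (λ R → not (eqV R P)) (λ _ S → eqV S P) ⟩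
    sumV v (λ R → 𝟙 (not (eqV R P)) * inΨ r R * sumV v (λ S → 𝟙 (eqV S P) * inΨ s S))
      ≡⟨ sumL-cong (allVecs v) (λ R → cong (𝟙 (not (eqV R P)) * inΨ r R *_) (sumV-pointMass (inΨ s) P)) ⟩
    sumV v (λ R → 𝟙 (not (eqV R P)) * inΨ r R * inΨ s P)                 ≡⟨ sumL-*ʳ (inΨ s P) _ (allVecs v) ⟩
    Ψ∖P r * inΨ s P                                                      ∎

  ΣΨ-R=S≠P : ΣΨ (λ R S → 𝟙 (R=S≠P R S)) ≡ Ψr∩Ψs∖P
  ΣΨ-R=S≠P = trans (ΣΨ-∧ (λ R → not (eqV R P)) (λ R S → eqV R S))
    (sumL-cong (allVecs v) (λ R → cong (𝟙 (not (eqV R P)) * inΨ r R *_) (sumV-pointMass′ (inΨ s) R)))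

  ΣΨ-S=P+R : ΣΨ (λ R S → 𝟙 (S=P+R R S)) ≡ sigmaP po P r s
  ΣΨ-S=P+R = begin
    ΣΨ (λ R S → 𝟙 (S=P+R R S))                                        ≡⟨ ΣΨ-∧ (λ R → not (eqV R P)) (λ R S → eqV (P ⊕ R) S) ⟩
    sumV v (λ R → 𝟙 (not (eqV R P)) * inΨ r R * sumV v (λ S → 𝟙 (eqV (P ⊕ R) S) * inΨ s S))
      ≡⟨ sumL-cong (allVecs v) (λ R → cong (𝟙 (not (eqV R P)) * inΨ r R *_) (sumV-pointMass′ (inΨ s) (P ⊕ R))) ⟩
    sumV v (λ R → 𝟙 (not (eqV R P)) * inΨ r R * inΨ s (P ⊕ R))        ≡⟨ sumL-cong (allVecs v) pointwise ⟩
    sumV v (λ R → 𝟙 (isPoint R ∧ (isIn (po R) r ∧ (not (eqV R P) ∧ isIn (po (P ⊕ R)) s))))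
      ≡⟨ sym (countL≡sumL-𝟙 _ (allVecs v)) ⟩
    sigmaP po P r s                                                   ∎
    where
    pointwise : ∀ R → 𝟙 (not (eqV R P)) * inΨ r R * inΨ s (P ⊕ R)
                    ≡ 𝟙 (isPoint R ∧ (isIn (po R) r ∧ (not (eqV R P) ∧ isIn (po (P ⊕ R)) s)))
    pointwise R with isPoint R | isIn (po R) r | eqV R P in R≡P
    ... | true | true | true = refl
    ... | true | true | false rewrite ⊕-isPoint {P = P} {R} R≡P = +-identityʳ _
    ... | true | false | e = x*0*y≡0 (𝟙 (not e)) _
    ... | false | _ | e = x*0*y≡0 (𝟙 (not e)) _

  Ψr∩Ψs∖P-disjoint : r ≢ s → Ψr∩Ψs∖P ≡ 0
  Ψr∩Ψs∖P-disjoint r≢s = trans (sumL-cong (allVecs v) pointwise) (sumL-zero (allVecs v))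
    where
    pointwise : ∀ R → 𝟙 (not (eqV R P)) * inΨ r R * inΨ s R ≡ 0
    pointwise R with isPoint R | isIn (po R) r in R∈r | isIn (po R) s in R∈s
    ... | false | _ | _ = *-zeroʳ (𝟙 (not (eqV R P)) * 0)
    ... | true | false | _ = x*0*y≡0 (𝟙 (not (eqV R P))) _
    ... | true | true | false = *-zeroʳ (𝟙 (not (eqV R P)) * 1)
    ... | true | true | true = ⊥-elim (r≢s (trans (sym (isIn⇒≡ R∈r)) (isIn⇒≡ R∈s)))

  Ψr∩Ψs∖P-equal : r ≡ s → Ψr∩Ψs∖P ≡ Ψ∖P r
  Ψr∩Ψs∖P-equal refl = sumL-cong (allVecs v) (λ R → trans (*-assoc (𝟙 (not (eqV R P))) (inΨ r R) (inΨ r R)) (cong (𝟙 (not (eqV R P)) *_) (𝟙-idem (isPoint R ∧ isIn (po R) r))))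
    where
    𝟙-idem : ∀ a → 𝟙 a * 𝟙 a ≡ 𝟙 a
    𝟙-idem true = refl
    𝟙-idem false = refl

  Φ≡phi3P : Φ ≡ phi3P B po P r s
  Φ≡phi3P = sym (begin
    phi3P B po P r s
      ≡⟨ sumL-cong (allVecs v) (λ R → outer (isPoint R) (isIn (po R) r) (sumL-cong (allVecs v) (inner R))) ⟩
    sumV v (λ R → inΨ r R * sumV v (λ S → inΨ s S * (blocksThrough₃ P R S * spanning R S)))
      ≡⟨ sumL-cong (allVecs v) (λ R → trans (sym (sumL-*ˡ (inΨ r R) _ (allVecs v)))
                                            (sumL-cong (allVecs v) (λ S → sym (*-assoc (inΨ r R) _ _)))) ⟩
    Φ ∎)
    where
    outer : ∀ p q {x y} → x ≡ y → (if p then (if q then x else 0) else 0) ≡ 𝟙 (p ∧ q) * y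
    outer true true x≡y = trans x≡y (sym (+-identityʳ _))
    outer true false _ = refl
    outer false q _ = refl
    inner : ∀ R S → (if isPoint S then (if isIn (po S) s ∧ indep R S
                      then countFin N (λ b → subsetB (spanL (P ∷ R ∷ S ∷ [])) (B b)) else 0) else 0)
                  ≡ inΨ s S * (blocksThrough₃ P R S * spanning R S)
    inner R S with isPoint S | isIn (po S) s | indep R S
    ... | true | true | true =
      trans (countFin-cong N (subsetB-span₃ P R S)) (sym (trans (+-identityʳ _) (*-identityʳ (blocksThrough₃ P R S))))
    ... | true | true | false = sym (trans (+-identityʳ _) (*-zeroʳ (blocksThrough₃ P R S)))
    ... | true | false | _ = refl
    ... | false | _ | _ = refl

  Φ≤ : ∀ φ → (∀ {R S} → isPoint R ≡ true → isPoint S ≡ true → indep R S ≡ true → blocksThrough₃ P R S ≤ φ) →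
    Φ ≤ ΣΨ spanning * φ
  Φ≤ φ bound = subst (Φ ≤_) (trans (ΣΨ-*ˡ φ spanning) (*-comm φ _)) (ΣΨ-mono pointwise)
    where
    pointwise : ∀ {R S} → isPoint R ≡ true → isPoint S ≡ true → blocksThrough₃ P R S * spanning R S ≤ φ * spanning R S
    pointwise {R} {S} R-pt S-pt with indep R S in R,S-indep
    ... | true = *-monoˡ-≤ 1 (bound R-pt S-pt R,S-indep)
    ... | false = ≤-reflexive (trans (*-zeroʳ (blocksThrough₃ P R S)) (sym (*-zeroʳ φ)))

  ΣΨ-one : ΣΨ (λ _ _ → 1) ≡ orbSize po r * orbSize po s
  ΣΨ-one = sym (begin
    orbSize po r * orbSize po s                      ≡⟨ cong₂ _*_ (countL≡sumL-𝟙 _ (allVecs v)) (countL≡sumL-𝟙 _ (allVecs v)) ⟩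
    sumV v (inΨ r) * sumV v (inΨ s)                  ≡⟨ sumL-*-sumL (inΨ r) (inΨ s) (allVecs v) (allVecs v) ⟩
    sumV v (λ R → sumV v (λ S → weight R S))         ≡⟨ sumL-cong (allVecs v) (λ R → sumL-cong (allVecs v) (λ S → sym (*-identityʳ _))) ⟩
    ΣΨ (λ _ _ → 1)                                   ∎)

  planar∖σ : ℕ
  planar∖σ = inΨ r P * Ψ∖P s + (Ψ∖P r * inΨ s P + Ψr∩Ψs∖P)

  ΣΨ-inPlane : ΣΨ inPlane ≡ planar∖σ + sigmaP po P r s
  ΣΨ-inPlane = begin
    ΣΨ inPlane
      ≡⟨ trans (ΣΨ-+ (λ R S → 𝟙 (R=P≠S R S)) _) (cong (ΣΨ (λ R S → 𝟙 (R=P≠S R S)) +_)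
           (trans (ΣΨ-+ (λ R S → 𝟙 (S=P≠R R S)) _) (cong (ΣΨ (λ R S → 𝟙 (S=P≠R R S)) +_) (ΣΨ-+ (λ R S → 𝟙 (R=S≠P R S)) _)))) ⟩
    ΣΨ (λ R S → 𝟙 (R=P≠S R S)) + (ΣΨ (λ R S → 𝟙 (S=P≠R R S)) + (ΣΨ (λ R S → 𝟙 (R=S≠P R S)) + ΣΨ (λ R S → 𝟙 (S=P+R R S))))
      ≡⟨ cong₂ _+_ ΣΨ-R=P≠S (cong₂ _+_ ΣΨ-S=P≠R (cong₂ _+_ ΣΨ-R=S≠P ΣΨ-S=P+R)) ⟩
    inΨ r P * Ψ∖P s + (Ψ∖P r * inΨ s P + (Ψr∩Ψs∖P + sigmaP po P r s))
      ≡⟨ reassociate (inΨ r P * Ψ∖P s) (Ψ∖P r * inΨ s P) Ψr∩Ψs∖P (sigmaP po P r s) ⟩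
    planar∖σ + sigmaP po P r s ∎
    where
    reassociate : ∀ a b c d → a + (b + (c + d)) ≡ a + (b + c) + d
    reassociate = solve-∀

  blocksSum-evaluated : blocksSum ≡ phi3P B po P r s + (blocksThrough₁ P * (inΨ r P * inΨ s P) + λ₂ * (planar∖σ + sigmaP po P r s))
  blocksSum-evaluated = begin
    blocksSum                                                   ≡⟨ blocksSum-byConfiguration ⟩
    Φ + (blocksThrough₁ P * ΣΨ onLine + λ₂ * ΣΨ inPlane)       ≡⟨ cong₂ (λ a b → a + (blocksThrough₁ P * b + λ₂ * ΣΨ inPlane)) Φ≡phi3P ΣΨ-onLine ⟩
    phi3P B po P r s + (blocksThrough₁ P * (inΨ r P * inΨ s P) + λ₂ * ΣΨ inPlane)
                                                                ≡⟨ cong (λ t → phi3P B po P r s + (blocksThrough₁ P * (inΨ r P * inΨ s P) + λ₂ * t)) ΣΨ-inPlane ⟩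
    phi3P B po P r s + (blocksThrough₁ P * (inΨ r P * inΨ s P) + λ₂ * (planar∖σ + sigmaP po P r s)) ∎

  orbSizes-evaluated : orbSize po r * orbSize po s ≡ ΣΨ spanning + (inΨ r P * inΨ s P + (planar∖σ + sigmaP po P r s))
  orbSizes-evaluated = begin
    orbSize po r * orbSize po s                          ≡⟨ sym ΣΨ-one ⟩
    ΣΨ (λ _ _ → 1)                                       ≡⟨ pairs-byConfiguration ⟩
    ΣΨ spanning + (ΣΨ onLine + ΣΨ inPlane)               ≡⟨ cong₂ (λ a b → ΣΨ spanning + (a + b)) ΣΨ-onLine ΣΨ-inPlane ⟩
    ΣΨ spanning + (inΨ r P * inΨ s P + (planar∖σ + sigmaP po P r s)) ∎

  phi3P-bound : ∀ φ → (∀ {R S} → isPoint R ≡ true → isPoint S ≡ true → indep R S ≡ true → blocksThrough₃ P R S ≤ φ) →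
    phi3P B po P r s + (inΨ r P * inΨ s P + (planar∖σ + sigmaP po P r s)) * φ ≤ orbSize po r * orbSize po s * φ
  phi3P-bound φ bound = subst₂ _≤_ (cong (_+ rest * φ) Φ≡phi3P) total (+-monoˡ-≤ (rest * φ) (Φ≤ φ bound))
    where
    rest : ℕ
    rest = inΨ r P * inΨ s P + (planar∖σ + sigmaP po P r s)
    total : ΣΨ spanning * φ + rest * φ ≡ orbSize po r * orbSize po s * φ
    total = trans (sym (*-distribʳ-+ φ (ΣΨ spanning) rest)) (cong (_* φ) (sym orbSizes-evaluated))

  module Cases {l : Fin m} (P∈Ψl : po P ≡ l) {φ : ℕ}
    (bound : ∀ {R S} → isPoint R ≡ true → isPoint S ≡ true → indep R S ≡ true → blocksThrough₃ P R S ≤ φ) where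

    σ ϕ3 : ℕ
    σ = sigmaP po P r s
    ϕ3 = phi3P B po P r s

    inΨ-P : ∀ i → inΨ i P ≡ 𝟙 (isIn l i)
    inΨ-P i rewrite P-pt | P∈Ψl = refl

    P∉Ψ : ∀ {i} → l ≢ i → inΨ i P ≡ 0
    P∉Ψ l≢i = trans (inΨ-P _) (cong 𝟙 (isIn-≢ l≢i))

    P∈Ψ : ∀ {i} → l ≡ i → inΨ i P ≡ 1
    P∈Ψ {i} refl = trans (inΨ-P l) (cong 𝟙 (isIn-refl l))

    orbSize≡ : ∀ {i} → l ≢ i → orbSize po i ≡ Ψ∖P i
    orbSize≡ {i} l≢i = trans (orbSize-split i) (trans (cong (Ψ∖P i +_) (P∉Ψ l≢i)) (+-identityʳ _))

    case-P∉Ψr∩Ψs : ∀ {x} → inΨ r P * inΨ s P ≡ 0 → planar∖σ ≡ x →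
      (blocksSum ≡ (x + σ) * λ₂ + ϕ3) × (ϕ3 + (x + σ) * φ ≤ orbSize po r * orbSize po s * φ)
    case-P∉Ψr∩Ψs {x} P∉Ψr∩Ψs planar∖σ≡x =
      trans blocksSum-evaluated (trans (cong₂ (λ a d → ϕ3 + (blocksThrough₁ P * a + λ₂ * (d + σ))) P∉Ψr∩Ψs planar∖σ≡x) (rearrange ϕ3 (blocksThrough₁ P) λ₂ x σ)) ,
      subst (λ t → ϕ3 + t * φ ≤ orbSize po r * orbSize po s * φ) (cong₂ (λ a d → a + (d + σ)) P∉Ψr∩Ψs planar∖σ≡x) (phi3P-bound φ bound)
      where
      rearrange : ∀ ϕ r₁ l x σ → ϕ + (r₁ * 0 + l * (x + σ)) ≡ (x + σ) * l + ϕ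
      rearrange = solve-∀

    case-distinct : l ≢ r → r ≢ s → s ≢ l →
      (blocksSum ≡ σ * λ₂ + ϕ3) × (ϕ3 + σ * φ ≤ orbSize po r * orbSize po s * φ)
    case-distinct l≢r r≢s s≢l = case-P∉Ψr∩Ψs (cong (_* inΨ s P) (P∉Ψ l≢r)) (begin
      inΨ r P * Ψ∖P s + (Ψ∖P r * inΨ s P + Ψr∩Ψs∖P)
        ≡⟨ cong₂ (λ a b → a * Ψ∖P s + (Ψ∖P r * b + Ψr∩Ψs∖P)) (P∉Ψ l≢r) (P∉Ψ (s≢l ∘ sym)) ⟩
      Ψ∖P r * 0 + Ψr∩Ψs∖P   ≡⟨ cong₂ _+_ (*-zeroʳ (Ψ∖P r)) (Ψr∩Ψs∖P-disjoint r≢s) ⟩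
      0                     ∎)

    case-mixed : (l ≡ r × r ≢ s) ⊎ (l ≢ r × r ≡ s) →
      (blocksSum ≡ (orbSize po s + σ) * λ₂ + ϕ3) × (ϕ3 + (orbSize po s + σ) * φ ≤ orbSize po r * orbSize po s * φ)
    case-mixed (inj₁ (l≡r , r≢s)) = case-P∉Ψr∩Ψs (cong₂ _*_ (P∈Ψ l≡r) (P∉Ψ l≢s)) (begin
      inΨ r P * Ψ∖P s + (Ψ∖P r * inΨ s P + Ψr∩Ψs∖P)
        ≡⟨ cong₂ (λ a b → a * Ψ∖P s + (Ψ∖P r * b + Ψr∩Ψs∖P)) (P∈Ψ l≡r) (P∉Ψ l≢s) ⟩
      1 * Ψ∖P s + (Ψ∖P r * 0 + Ψr∩Ψs∖P)
        ≡⟨ cong₂ (λ a b → a + (b + Ψr∩Ψs∖P)) (*-identityˡ (Ψ∖P s)) (*-zeroʳ (Ψ∖P r)) ⟩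
      Ψ∖P s + Ψr∩Ψs∖P       ≡⟨ cong (Ψ∖P s +_) (Ψr∩Ψs∖P-disjoint r≢s) ⟩
      Ψ∖P s + 0             ≡⟨ +-identityʳ _ ⟩
      Ψ∖P s                 ≡⟨ sym (orbSize≡ l≢s) ⟩
      orbSize po s          ∎)
      where
      l≢s : l ≢ s
      l≢s l≡s = r≢s (trans (sym l≡r) l≡s)
    case-mixed (inj₂ (l≢r , r≡s)) = case-P∉Ψr∩Ψs (cong (_* inΨ s P) (P∉Ψ l≢r)) (begin
      inΨ r P * Ψ∖P s + (Ψ∖P r * inΨ s P + Ψr∩Ψs∖P)
        ≡⟨ cong₂ (λ a b → a * Ψ∖P s + (Ψ∖P r * b + Ψr∩Ψs∖P)) (P∉Ψ l≢r) (P∉Ψ l≢s) ⟩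
      Ψ∖P r * 0 + Ψr∩Ψs∖P   ≡⟨ cong₂ _+_ (*-zeroʳ (Ψ∖P r)) (Ψr∩Ψs∖P-equal r≡s) ⟩
      Ψ∖P r                 ≡⟨ sym (orbSize≡ l≢r) ⟩
      orbSize po r          ≡⟨ cong (orbSize po) r≡s ⟩
      orbSize po s          ∎)
      where
      l≢s : l ≢ s
      l≢s l≡s = l≢r (trans l≡s (sym r≡s))

    module _ (l≡r : l ≡ r) (r≡s : r ≡ s) where

      Ψl≡Ψ∖P+1 : orbSize po l ≡ Ψ∖P r + 1
      Ψl≡Ψ∖P+1 = trans (cong (orbSize po) l≡r) (trans (orbSize-split r) (cong (Ψ∖P r +_) (P∈Ψ l≡r)))

      planar∖σ+3 : planar∖σ + 3 ≡ 3 * orbSize po l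
      planar∖σ+3 = begin
        inΨ r P * Ψ∖P s + (Ψ∖P r * inΨ s P + Ψr∩Ψs∖P) + 3
          ≡⟨ cong₂ (λ a b → a * Ψ∖P s + (Ψ∖P r * b + Ψr∩Ψs∖P) + 3) (P∈Ψ l≡r) (P∈Ψ (trans l≡r r≡s)) ⟩
        1 * Ψ∖P s + (Ψ∖P r * 1 + Ψr∩Ψs∖P) + 3
          ≡⟨ cong₂ (λ a b → 1 * a + (Ψ∖P r * 1 + b) + 3) (cong Ψ∖P (sym r≡s)) (Ψr∩Ψs∖P-equal r≡s) ⟩
        1 * Ψ∖P r + (Ψ∖P r * 1 + Ψ∖P r) + 3  ≡⟨ threeLines (Ψ∖P r) ⟩
        3 * (Ψ∖P r + 1)                       ≡⟨ cong (3 *_) (sym Ψl≡Ψ∖P+1) ⟩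
        3 * orbSize po l                      ∎
        where
        threeLines : ∀ d → 1 * d + (d * 1 + d) + 3 ≡ 3 * (d + 1)
        threeLines = solve-∀

      P∈Ψr∩Ψs : inΨ r P * inΨ s P ≡ 1
      P∈Ψr∩Ψs = cong₂ _*_ (P∈Ψ l≡r) (P∈Ψ (trans l≡r r≡s))

      case-equal : (blocksSum + 3 * λ₂ ≡ blocksThrough₁ P + (3 * orbSize po l + σ) * λ₂ + ϕ3)
                   × (ϕ3 + (3 * orbSize po l + σ) * φ ≤ (orbSize po l * orbSize po l + 2) * φ)
      case-equal = identity , bound′
        where
        rearrange : ∀ ϕ r₁ l x σ → ϕ + (r₁ * 1 + l * (x + σ)) + 3 * l ≡ r₁ + (x + 3 + σ) * l + ϕ
        rearrange = solve-∀
        identity : blocksSum + 3 * λ₂ ≡ blocksThrough₁ P + (3 * orbSize po l + σ) * λ₂ + ϕ3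
        identity = begin
          blocksSum + 3 * λ₂
            ≡⟨ cong (_+ 3 * λ₂) (trans blocksSum-evaluated (cong (λ a → ϕ3 + (blocksThrough₁ P * a + λ₂ * (planar∖σ + σ))) P∈Ψr∩Ψs)) ⟩
          ϕ3 + (blocksThrough₁ P * 1 + λ₂ * (planar∖σ + σ)) + 3 * λ₂
            ≡⟨ rearrange ϕ3 (blocksThrough₁ P) λ₂ planar∖σ σ ⟩
          blocksThrough₁ P + (planar∖σ + 3 + σ) * λ₂ + ϕ3
            ≡⟨ cong (λ t → blocksThrough₁ P + (t + σ) * λ₂ + ϕ3) planar∖σ+3 ⟩
          blocksThrough₁ P + (3 * orbSize po l + σ) * λ₂ + ϕ3 ∎
        regroup : ∀ ϕ x σ φ → ϕ + (1 + (x + σ)) * φ + 2 * φ ≡ ϕ + (x + 3 + σ) * φ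
        regroup = solve-∀
        ΨrΨs≡ΨlΨl : orbSize po r * orbSize po s ≡ orbSize po l * orbSize po l
        ΨrΨs≡ΨlΨl = sym (cong₂ _*_ (cong (orbSize po) l≡r) (cong (orbSize po) (trans l≡r r≡s)))
        bound′ : ϕ3 + (3 * orbSize po l + σ) * φ ≤ (orbSize po l * orbSize po l + 2) * φ
        bound′ = subst₂ _≤_
          (trans (regroup ϕ3 planar∖σ σ φ) (cong (λ t → ϕ3 + (t + σ) * φ) planar∖σ+3))
          (trans (sym (*-distribʳ-+ φ (orbSize po r * orbSize po s) 2)) (cong (λ t → (t + 2) * φ) ΨrΨs≡ΨlΨl))
          (+-monoˡ-≤ (2 * φ) (subst (λ a → ϕ3 + (a + (planar∖σ + σ)) * φ ≤ orbSize po r * orbSize po s * φ)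
                                    P∈Ψr∩Ψs (phi3P-bound φ bound)))

-- Regrouping by block orbits

sumFin-byClasses : ∀ {N n} (cls : Fin N → Fin n) (rep : Fin n → Fin N) (p : Fin N → Bool) (g : Fin N → ℕ) →
  (∀ β → g (rep (cls β)) ≡ g β) →
  sumFin n (λ j → countFin N (λ β → isIn (cls β) j ∧ p β) * g (rep j)) ≡ sumFin N (λ β → 𝟙 (p β) * g β)
sumFin-byClasses {N} {n} cls rep p g g-classFunction = begin
  sumFin n (λ j → countFin N (λ β → isIn (cls β) j ∧ p β) * g (rep j))
    ≡⟨ sumL-cong (allFin n) (λ j → trans (cong (_* g (rep j)) (countFin≡sumFin-𝟙 N _)) (sym (sumL-*ʳ (g (rep j)) _ (allFin N)))) ⟩
  sumFin n (λ j → sumFin N (λ β → 𝟙 (isIn (cls β) j ∧ p β) * g (rep j)))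
    ≡⟨ sumL-comm _ (allFin n) (allFin N) ⟩
  sumFin N (λ β → sumFin n (λ j → 𝟙 (isIn (cls β) j ∧ p β) * g (rep j)))
    ≡⟨ sumL-cong (allFin N) (λ β → sumL-cong (allFin n) (pointwise β)) ⟩
  sumFin N (λ β → sumFin n (λ j → 𝟙 (isIn (cls β) j) * (𝟙 (p β) * g β)))
    ≡⟨ sumL-cong (allFin N) (λ β → sumFin-indicator n (cls β) (λ _ → 𝟙 (p β) * g β)) ⟩
  sumFin N (λ β → 𝟙 (p β) * g β) ∎
  where
  pointwise : ∀ β j → 𝟙 (isIn (cls β) j ∧ p β) * g (rep j) ≡ 𝟙 (isIn (cls β) j) * (𝟙 (p β) * g β)
  pointwise β j with isIn (cls β) j in β∈j
  ... | false = refl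
  ... | true rewrite sym (isIn⇒≡ β∈j) = trans (cong (𝟙 (p β) *_) (g-classFunction β)) (sym (+-identityʳ _))

kappaB-invariant : ∀ {v m} (po : Vect v → Fin m) {g g⁻¹ : Mat v} → Inverse g g⁻¹ →
  (∀ x → isPoint x ≡ true → po (act g x) ≡ po x) →
  ∀ i {X Y : SubsetV v} → (∀ x → Y (act g x) ≡ X x) → kappaB po i Y ≡ kappaB po i X
kappaB-invariant po {g} inv po-invariant i {X} {Y} Y∘g≗X = begin
  kappaB po i Y                                     ≡⟨ sym (countPts-act inv (λ x → isIn (po x) i ∧ Y x)) ⟩
  countPts (λ x → isIn (po (act g x)) i ∧ Y (act g x))  ≡⟨ countPts-cong pointwise ⟩
  kappaB po i X                                     ∎
  where
  pointwise : ∀ x → isPoint x ≡ true → (isIn (po (act g x)) i ∧ Y (act g x)) ≡ (isIn (po x) i ∧ X x)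
  pointwise x x-pt = cong₂ (λ a b → isIn a i ∧ b) (po-invariant x x-pt) (Y∘g≗X x)

kappaB-G-invariant : ∀ {v m} {G : Mat v → Set} → IsSubgroupGL G → (po : Vect v → Fin m) →
  (∀ P Q → isPoint P ≡ true → isPoint Q ≡ true → (po P ≡ po Q) ⇔ Σ (Mat v) (λ g → G g × (act g P ≡ Q))) →
  ∀ {g} → G g → ∀ i {X Y : SubsetV v} → (∀ x → Y (act g x) ≡ X x) → kappaB po i Y ≡ kappaB po i X
kappaB-G-invariant (_ , _ , G-inverse) po po-orbits {g} g∈G i Y∘g≗X with G-inverse g g∈G
... | g⁻¹ , _ , right , left = kappaB-invariant po inv po∘g≗po i Y∘g≗X
  where
  inv : Inverse g g⁻¹
  inv = matrixInverse⇒Inverse right left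
  po∘g≗po : ∀ x → isPoint x ≡ true → po (act g x) ≡ po x
  po∘g≗po x x-pt = sym (Equivalence.from (po-orbits x (act g x) x-pt (trans (act-isPoint inv x) x-pt)) (g , g∈G , refl))

mainTheorem4 :
  (v k λ₂ : ℕ) → 2 ≤ k → k ≤ v →
  -- the design: N blocks, each a k-dimensional subspace, pairwise distinct
  (N : ℕ) (B : Fin N → SubsetV v) →
  (∀ b → IsSubspaceDim k (B b)) →
  (∀ b b′ → (∀ x → B b x ≡ B b′ x) → b ≡ b′) →
  -- every 2-dimensional subspace lies in exactly λ₂ blocks
  (∀ U → IsSubspaceDim 2 U → countFin N (λ b → subsetB U (B b)) ≡ λ₂) →
  -- G ≤ GL_v(2) is an automorphism group of the design
  (G : Mat v → Set) → IsSubgroupGL G →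
  (∀ g → G g → ∀ b → Σ (Fin N) λ b′ → ∀ x → B b′ (act g x) ≡ B b x) →
  -- point orbits Ψ_1, …, Ψ_m (po P = index of the orbit of P)
  (m : ℕ) (po : Vect v → Fin m) →
  (∀ P Q → isPoint P ≡ true → isPoint Q ≡ true →
     (po P ≡ po Q) ⇔ Σ (Mat v) (λ g → G g × (act g P ≡ Q))) →
  (∀ i → Σ (Vect v) λ P → (isPoint P ≡ true) × (po P ≡ i)) →
  -- block orbits B_1, …, B_n (bo b = index of the orbit of block b)
  (n : ℕ) (bo : Fin N → Fin n) →
  (∀ b b′ → (bo b ≡ bo b′) ⇔ Σ (Mat v) (λ g → G g × (∀ x → B b′ (act g x) ≡ B b x))) →
  (∀ j → Σ (Fin N) λ b → bo b ≡ j) →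
  -- λ₁ = λ₂ (2^(v-1) - 1) / (2^(k-1) - 1)
  (λ₁ : ℕ) → λ₁ * (2 ^ (k ∸ 1) ∸ 1) ≡ λ₂ * (2 ^ (v ∸ 1) ∸ 1) →
  -- l, r, s, a point P ∈ Ψ_l, and representatives of the block orbits
  (l r s : Fin m) (P : Vect v) → isPoint P ≡ true → po P ≡ l →
  (rep : Fin n → Fin N) → (∀ j → bo (rep j) ≡ j) →
  let φ   = minℕ λ₂ (gaussVK3 v k)
      σ   = sigmaP po P r s
      ϕ3  = phi3P B po P r s
      Ψl  = orbSize po l
      Ψr  = orbSize po r
      Ψs  = orbSize po s
      LHS = sumFin n (λ j → rhoP B bo P j * kappaB po r (B (rep j)) * kappaB po s (B (rep j)))
  in
  -- case l ≠ r ≠ s ≠ l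
  ((l ≢ r → r ≢ s → s ≢ l →
     (LHS ≡ σ * λ₂ + ϕ3) × (ϕ3 + σ * φ ≤ Ψr * Ψs * φ))
  -- case l = r = s
  × (l ≡ r → r ≡ s →
     (LHS + 3 * λ₂ ≡ λ₁ + (3 * Ψl + σ) * λ₂ + ϕ3)
     × (ϕ3 + (3 * Ψl + σ) * φ ≤ (Ψl * Ψl + 2) * φ))
  -- case l = r ≠ s  or  l ≠ r = s
  × (((l ≡ r × r ≢ s) ⊎ (l ≢ r × r ≡ s)) →
     (LHS ≡ (Ψs + σ) * λ₂ + ϕ3)
     × (ϕ3 + (Ψs + σ) * φ ≤ Ψr * Ψs * φ)))
mainTheorem4 v k λ₂ 2≤k k≤v N B B-dim B-inj B-λ₂ G G≤GL _ m po po-orbits _ n bo bo-orbits _ λ₁ λ₁-eq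
             l r s P P-pt P∈Ψl rep rep-section =
  (λ l≢r r≢s s≢l → map₁ (trans LHS≡blocksSum) (case-distinct l≢r r≢s s≢l)) ,
  (λ l≡r r≡s → map₁ (λ eq → trans (cong (_+ 3 * λ₂) LHS≡blocksSum) (trans eq (cong (λ t → t + _ + _) r₁≡λ₁)))
                     (case-equal l≡r r≡s)) ,
  (map₁ (trans LHS≡blocksSum) ∘ case-mixed)
  where
  open Design B B-dim B-λ₂
  open PairCount B B-dim B-λ₂ P P-pt po r s
  open DistinctSubspaces B B-dim B-inj using (countThrough≤gaussVK3)
  open Cases P∈Ψl (λ R-pt S-pt R,S-indep →
    ⊓-glb (blocksThrough₃≤λ₂ P P-pt R-pt S-pt R,S-indep)
          (countThrough≤gaussVK3 (≡ᵇ⇒≡ _ 3 (subst T (sym R,S-indep) tt)) k≤v))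

  r₁≡λ₁ : blocksThrough₁ P ≡ λ₁
  r₁≡λ₁ = λ₁-unique {λ₂ = λ₂} 2≤k k≤v (blocksThrough₁-count P P-pt) λ₁-eq

  κ-classFunction : ∀ i β → kappaB po i (B (rep (bo β))) ≡ kappaB po i (B β)
  κ-classFunction i β with Equivalence.to (bo-orbits β (rep (bo β))) (sym (rep-section (bo β)))
  ... | _ , g∈G , B-rep∘g≗B = kappaB-G-invariant G≤GL po po-orbits g∈G i B-rep∘g≗B

  LHS≡blocksSum : sumFin n (λ j → rhoP B bo P j * kappaB po r (B (rep j)) * kappaB po s (B (rep j))) ≡ blocksSum
  LHS≡blocksSum = trans (sumL-cong (allFin n) (λ j → *-assoc (rhoP B bo P j) _ _))
    (trans (sumFin-byClasses bo rep (λ β → B β P) (λ β → kappaB po r (B β) * kappaB po s (B β))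
                             (λ β → cong₂ _*_ (κ-classFunction r β) (κ-classFunction s β)))
           (sumL-cong (allFin N) (λ β → sym (*-assoc (𝟙 (B β P)) _ _))))
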